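{- For every integer $n\ge 0$, \[\sum_{m=0}^{n}\frac{d_{2m,n+1}}{(2n-2m)!} \sum_{k=0}^{n}\binom{4n+2}{2n-2k}\,(2k+1)^{2n-2m} = \frac{4^{n}}{2n+1}.\]
   Context: For integers $k\ge0$, $r\ge1$, $d_{k,r}$ denotes the coefficient of $x^k$ in the Taylor expansion at $0$ of $\left(\frac{x}{\sinh x}\right)^{2r}$. -}

module Defs where

open import Data.Nat as ℕ using (ℕ; zero; suc; _!; _∸_)
open import Data.Nat.Properties using (_!≢0)
open import Data.Nat.Combinatorics using (_C_)
open import Data.Integer using (+_)
open import Data.Rational using (ℚ; 0ℚ; 1ℚ; _+_; _*_; -_; _/_)
open import Data.List using (List; []; _∷_; foldr; map; upTo; zipWith)

sumTo : ℕ → (ℕ → ℚ) → ℚ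
sumTo n f = foldr _+_ 0ℚ (map f (upTo (suc n)))

Series : Set
Series = ℕ → ℚ

invFact : ℕ → ℚ
invFact n = _/_ (+ 1) (n !) {{n !≢0}}

_⊛_ : Series → Series → Series
(f ⊛ g) k = sumTo k (λ i → f i * g (k ∸ i))

oneS : Series
oneS zero = 1ℚ
oneS (suc _) = 0ℚ

_^S_ : Series → ℕ → Series
f ^S zero = oneS
f ^S suc r = f ⊛ (f ^S r)

-- Taylor series of sinh x / x = Σ_j x^(2j) / (2j+1)!
sinhc : Series
sinhc zero = 1ℚ
sinhc (suc zero) = 0ℚ
sinhc (suc (suc k)) = evenPart (suc (suc k)) k
  where
  evenPart : ℕ → ℕ → ℚ
  evenPart k' zero = invFact (suc k')
  evenPart k' (suc zero) = 0ℚ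
  evenPart k' (suc (suc j)) = evenPart k' j

-- Reciprocal of a power series f with constant term 1:
-- b 0 = 1,  b (n+1) = - Σ_{i=1}^{n+1} f i * b (n+1-i).
-- recipList f n = [b n , b (n-1) , … , b 0]
recipList : Series → ℕ → List ℚ
recipList f zero = 1ℚ ∷ []
recipList f (suc n) =
  (- foldr _+_ 0ℚ (zipWith _*_ (map (λ i → f (suc i)) (upTo (suc n))) prev)) ∷ prev
  where
  prev = recipList f n

headOr0 : List ℚ → ℚ
headOr0 [] = 0ℚ
headOr0 (x ∷ _) = x

recip1 : Series → Series
recip1 f k = headOr0 (recipList f k)

-- d k r = coefficient of x^k in (x / sinh x)^(2r) = 1 / (sinh x / x)^(2r)
d : ℕ → ℕ → ℚ
d k r = recip1 (sinhc ^S (2 ℕ.* r)) k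

ℕ→ℚ : ℕ → ℚ
ℕ→ℚ n = _/_ (+ n) 1

-- The numbers d_{2m,n+1} are the coefficients of R = (x / sinh x)^(2n+2). By the binomial theorem,
-- pairing the terms ℓ and 4n+2−ℓ, the inner sums are the even coefficients of the even series
-- H = ¼ ((e^{x/2} + e^{-x/2})^(4n+2) + (e^{x/2} − e^{-x/2})^(4n+2)), so the left-hand side is the
-- coefficient of x^(2n) in R·H. The second summand of H is divisible by x^(4n+2) and contributes
-- nothing; the first contributes ¼ · 2^(4n+2) · [x^(2n)] σ² A^(2n), where σ = (x/2) / sinh(x/2) and
-- A = (x/2) coth(x/2). With θ = x d/dx, A satisfies the Riccati equation θA = x²/4 + A − A², and
-- σ² = A − θA. Hence σ² A^m = A^(m+1) − θ(A^(m+1)) / (m+1), so [x^m] σ² A^m = P m / (m+1) with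
-- P m = [x^m] A^(m+1), while the Riccati equation gives P (m+2) = P m / 4 and P 0 = 1.

module Submission where

open import Defs
open import Level using (0ℓ)
open import Function using (_∘_; id)
open import Data.Product using (_,_)
open import Data.Maybe using (Maybe; just; nothing)
open import Relation.Nullary using (yes; no)
open import Data.List using (_∷_; foldr; map; applyUpTo; zipWith)
open import Data.Fin as Fin using (Fin; toℕ)
open import Data.Nat as ℕ using (ℕ; zero; suc; _!; _∸_; _^_)
import Data.Nat.Properties as ℕ
open import Data.Nat.Properties using (_!≢0)
open import Data.Nat.Combinatorics using (_C_; nCk≡nC[n∸k])
open import Data.Nat.Tactic.RingSolver using (solve-∀)
open import Data.Integer as ℤ using (+_)
import Data.Integer.Properties as ℤ
open import Data.Rational using (ℚ; 0ℚ; 1ℚ; _+_; _*_; -_; _/_; toℚᵘ)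
open import Data.Rational.Properties
open import Data.Rational.Solver using (module +-*-Solver)
import Data.Rational.Unnormalised as ℚᵘ
import Data.Rational.Unnormalised.Properties as ℚᵘ
open import Algebra.Bundles using (CommutativeRing; RawRing)
open import Algebra.Definitions.RawMonoid using (sum)
open import Algebra.Solver.Ring.AlmostCommutativeRing using (fromCommutativeRing; _-Raw-AlmostCommutative⟶_)
import Algebra.Solver.Ring
import Relation.Binary.Reasoning.Setoid
open import Algebra.Properties.CommutativeSemiring.Exp (CommutativeRing.commutativeSemiring +-*-commutativeRing)
  using () renaming (_^_ to _^ℚ_)
open import Relation.Binary.PropositionalEquality


toℚᵘ-/ : ∀ a e → toℚᵘ (+ a / suc e) ℚᵘ.≃ ℚᵘ.mkℚᵘ (+ a) e
toℚᵘ-/ a e = toℚᵘ-fromℚᵘ (ℚᵘ.mkℚᵘ (+ a) e)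

ℕ→ℚ-suc : ∀ n → ℕ→ℚ (suc n) ≡ 1ℚ + ℕ→ℚ n
ℕ→ℚ-suc n = toℚᵘ-injective (begin
    toℚᵘ (ℕ→ℚ (suc n))                       ≈⟨ toℚᵘ-/ (suc n) 0 ⟩
    ℚᵘ.mkℚᵘ (+ suc n) 0                      ≈⟨ ℚᵘ.*≡* (cong (ℤ._* + 1) eq) ⟩
    ℚᵘ.mkℚᵘ (+ 1) 0 ℚᵘ.+ ℚᵘ.mkℚᵘ (+ n) 0     ≈⟨ ℚᵘ.+-cong (toℚᵘ-/ 1 0) (toℚᵘ-/ n 0) ⟨
    toℚᵘ 1ℚ ℚᵘ.+ toℚᵘ (ℕ→ℚ n)                ≈⟨ toℚᵘ-homo-+ 1ℚ (ℕ→ℚ n) ⟨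
    toℚᵘ (1ℚ + ℕ→ℚ n)                        ∎)
  where
  open ℚᵘ.≃-Reasoning
  eq : + suc n ≡ + 1 ℤ.* + 1 ℤ.+ + n ℤ.* + 1
  eq = cong (ℤ._+_ (+ 1)) (sym (ℤ.*-identityʳ (+ n)))

ℕ→ℚ-homo-+ : ∀ m n → ℕ→ℚ (m ℕ.+ n) ≡ ℕ→ℚ m + ℕ→ℚ n
ℕ→ℚ-homo-+ zero    n = sym (+-identityˡ (ℕ→ℚ n))
ℕ→ℚ-homo-+ (suc m) n = begin
  ℕ→ℚ (suc (m ℕ.+ n))          ≡⟨ ℕ→ℚ-suc (m ℕ.+ n) ⟩
  1ℚ + ℕ→ℚ (m ℕ.+ n)           ≡⟨ cong (_+_ 1ℚ) (ℕ→ℚ-homo-+ m n) ⟩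
  1ℚ + (ℕ→ℚ m + ℕ→ℚ n)         ≡⟨ +-assoc 1ℚ (ℕ→ℚ m) (ℕ→ℚ n) ⟨
  1ℚ + ℕ→ℚ m + ℕ→ℚ n           ≡⟨ cong (_+ ℕ→ℚ n) (ℕ→ℚ-suc m) ⟨
  ℕ→ℚ (suc m) + ℕ→ℚ n          ∎
  where open ≡-Reasoning

ℕ→ℚ-homo-* : ∀ m n → ℕ→ℚ (m ℕ.* n) ≡ ℕ→ℚ m * ℕ→ℚ n
ℕ→ℚ-homo-* zero    n = sym (*-zeroˡ (ℕ→ℚ n))
ℕ→ℚ-homo-* (suc m) n = begin
  ℕ→ℚ (n ℕ.+ m ℕ.* n)          ≡⟨ ℕ→ℚ-homo-+ n (m ℕ.* n) ⟩
  ℕ→ℚ n + ℕ→ℚ (m ℕ.* n)        ≡⟨ cong (_+_ (ℕ→ℚ n)) (ℕ→ℚ-homo-* m n) ⟩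
  ℕ→ℚ n + ℕ→ℚ m * ℕ→ℚ n        ≡⟨ solve 2 (λ x y → y :+ x :* y := (con 1ℚ :+ x) :* y) refl (ℕ→ℚ m) (ℕ→ℚ n) ⟩
  (1ℚ + ℕ→ℚ m) * ℕ→ℚ n         ≡⟨ cong (_* ℕ→ℚ n) (ℕ→ℚ-suc m) ⟨
  ℕ→ℚ (suc m) * ℕ→ℚ n          ∎
  where
  open ≡-Reasoning
  open +-*-Solver

a/d≡a*1/d : ∀ a d .{{_ : ℕ.NonZero d}} → + a / d ≡ ℕ→ℚ a * (+ 1 / d)
a/d≡a*1/d a d@(suc e) = toℚᵘ-injective (begin
    toℚᵘ (+ a / d)
      ≈⟨ toℚᵘ-/ a e ⟩
    ℚᵘ.mkℚᵘ (+ a) e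
      ≈⟨ ℚᵘ.*≡* (trans (cong (ℤ._*_ (+ a)) (ℤ.*-identityˡ (+ d))) (cong (ℤ._* + d) (sym (ℤ.*-identityʳ (+ a))))) ⟩
    ℚᵘ.mkℚᵘ (+ a) 0 ℚᵘ.* ℚᵘ.mkℚᵘ (+ 1) e
      ≈⟨ ℚᵘ.*-cong (toℚᵘ-/ a 0) (toℚᵘ-/ 1 e) ⟨
    toℚᵘ (ℕ→ℚ a) ℚᵘ.* toℚᵘ (+ 1 / d)
      ≈⟨ toℚᵘ-homo-* (ℕ→ℚ a) (+ 1 / d) ⟨
    toℚᵘ (ℕ→ℚ a * (+ 1 / d))                         ∎)
  where
  open ℚᵘ.≃-Reasoning

1/d*d≡1 : ∀ d .{{_ : ℕ.NonZero d}} → + 1 / d * ℕ→ℚ d ≡ 1ℚ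
1/d*d≡1 d@(suc e) = toℚᵘ-injective (begin
    toℚᵘ (+ 1 / d * ℕ→ℚ d)                           ≈⟨ toℚᵘ-homo-* (+ 1 / d) (ℕ→ℚ d) ⟩
    toℚᵘ (+ 1 / d) ℚᵘ.* toℚᵘ (ℕ→ℚ d)                 ≈⟨ ℚᵘ.*-cong (toℚᵘ-/ 1 e) (toℚᵘ-/ d 0) ⟩
    ℚᵘ.mkℚᵘ (+ 1) e ℚᵘ.* ℚᵘ.mkℚᵘ (+ d) 0             ≈⟨ ℚᵘ.*≡* (ℤ.*-assoc (+ 1) (+ d) (+ 1)) ⟩
    ℚᵘ.mkℚᵘ (+ 1) 0                                  ≈⟨ toℚᵘ-/ 1 0 ⟨
    toℚᵘ 1ℚ                                          ∎)
  where
  open ℚᵘ.≃-Reasoning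

*-cancelˡ-ℕ→ℚ-suc : ∀ k {x y} → ℕ→ℚ (suc k) * x ≡ ℕ→ℚ (suc k) * y → x ≡ y
*-cancelˡ-ℕ→ℚ-suc k {x} {y} eq = trans (unscale x) (trans (cong (_*_ (+ 1 / suc k)) eq) (sym (unscale y)))
  where
  unscale : ∀ z → z ≡ + 1 / suc k * (ℕ→ℚ (suc k) * z)
  unscale z = begin
    z                                         ≡⟨ *-identityˡ z ⟨
    1ℚ * z                                    ≡⟨ cong (_* z) (1/d*d≡1 (suc k)) ⟨
    + 1 / suc k * ℕ→ℚ (suc k) * z             ≡⟨ *-assoc (+ 1 / suc k) (ℕ→ℚ (suc k)) z ⟩
    + 1 / suc k * (ℕ→ℚ (suc k) * z)           ∎
    where open ≡-Reasoning

invFact-suc : ∀ k → invFact (suc k) * ℕ→ℚ (suc k) ≡ invFact k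
invFact-suc k = begin
  i′ * n                      ≡⟨ *-identityʳ (i′ * n) ⟨
  i′ * n * 1ℚ                 ≡⟨ cong (_*_ (i′ * n)) (trans (*-comm (ℕ→ℚ (k !)) i) (1/d*d≡1 (k !) {{k !≢0}})) ⟨
  i′ * n * (ℕ→ℚ (k !) * i)    ≡⟨ solve 4 (λ a b c d → a :* b :* (c :* d) := a :* (b :* c) :* d) refl i′ n (ℕ→ℚ (k !)) i ⟩
  i′ * (n * ℕ→ℚ (k !)) * i    ≡⟨ cong (λ z → i′ * z * i) (ℕ→ℚ-homo-* (suc k) (k !)) ⟨
  i′ * ℕ→ℚ (suc k !) * i      ≡⟨ cong (_* i) (1/d*d≡1 (suc k !) {{suc k !≢0}}) ⟩
  1ℚ * i                      ≡⟨ *-identityˡ i ⟩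
  i                           ∎
  where
  open ≡-Reasoning
  open +-*-Solver
  i = invFact k
  i′ = invFact (suc k)
  n = ℕ→ℚ (suc k)

1^ℚ : ∀ n → 1ℚ ^ℚ n ≡ 1ℚ
1^ℚ zero    = refl
1^ℚ (suc n) = trans (*-identityˡ (1ℚ ^ℚ n)) (1^ℚ n)

ℕ→ℚ-homo-^ : ∀ a j → ℕ→ℚ (a ^ j) ≡ ℕ→ℚ a ^ℚ j
ℕ→ℚ-homo-^ a zero    = refl
ℕ→ℚ-homo-^ a (suc j) = trans (ℕ→ℚ-homo-* a (a ^ j)) (cong (_*_ (ℕ→ℚ a)) (ℕ→ℚ-homo-^ a j))

-1^-even : ∀ m → (- 1ℚ) ^ℚ (2 ℕ.* m) ≡ 1ℚ
-1^-even zero    = refl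
-1^-even (suc m) = begin
  (- 1ℚ) ^ℚ (2 ℕ.* suc m)                     ≡⟨ cong ((- 1ℚ) ^ℚ_) (ℕ.*-suc 2 m) ⟩
  - 1ℚ * (- 1ℚ * (- 1ℚ) ^ℚ (2 ℕ.* m))         ≡⟨ solve 1 (λ p → :- con 1ℚ :* (:- con 1ℚ :* p) := p) refl ((- 1ℚ) ^ℚ (2 ℕ.* m)) ⟩
  (- 1ℚ) ^ℚ (2 ℕ.* m)                         ≡⟨ -1^-even m ⟩
  1ℚ                                          ∎
  where
  open ≡-Reasoning
  open +-*-Solver

neg-^ : ∀ a j → (- a) ^ℚ j ≡ (- 1ℚ) ^ℚ j * a ^ℚ j
neg-^ a zero    = refl
neg-^ a (suc j) = trans (cong (_*_ (- a)) (neg-^ a j))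
  (solve 3 (λ a s p → :- a :* (s :* p) := :- con 1ℚ :* s :* (a :* p)) refl a ((- 1ℚ) ^ℚ j) (a ^ℚ j))
  where open +-*-Solver

Σ : ℕ → (ℕ → ℚ) → ℚ
Σ zero    f = 0ℚ
Σ (suc n) f = f 0 + Σ n (f ∘ suc)

sumTo≡Σ : ∀ n f → sumTo n f ≡ Σ (suc n) f
sumTo≡Σ n f = foldr-map-applyUpTo (suc n) id
  where
  foldr-map-applyUpTo : ∀ m g → foldr _+_ 0ℚ (map f (applyUpTo g m)) ≡ Σ m (f ∘ g)
  foldr-map-applyUpTo zero    g = refl
  foldr-map-applyUpTo (suc m) g = cong (_+_ (f (g 0))) (foldr-map-applyUpTo m (g ∘ suc))

Σ-cong-< : ∀ n {f g} → (∀ i → i ℕ.< n → f i ≡ g i) → Σ n f ≡ Σ n g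
Σ-cong-< zero    eq = refl
Σ-cong-< (suc n) eq = cong₂ _+_ (eq 0 (ℕ.s≤s ℕ.z≤n)) (Σ-cong-< n (λ i i<n → eq (suc i) (ℕ.s≤s i<n)))

Σ-cong : ∀ n {f g} → (∀ i → f i ≡ g i) → Σ n f ≡ Σ n g
Σ-cong n eq = Σ-cong-< n (λ i _ → eq i)

Σ-zero : ∀ n → Σ n (λ _ → 0ℚ) ≡ 0ℚ
Σ-zero zero    = refl
Σ-zero (suc n) = trans (+-identityˡ _) (Σ-zero n)

Σ-distrib-+ : ∀ n f g → Σ n (λ i → f i + g i) ≡ Σ n f + Σ n g
Σ-distrib-+ zero    f g = refl
Σ-distrib-+ (suc n) f g = trans (cong (_+_ (f 0 + g 0)) (Σ-distrib-+ n (f ∘ suc) (g ∘ suc)))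
  (solve 4 (λ a b c d → (a :+ b) :+ (c :+ d) := (a :+ c) :+ (b :+ d)) refl (f 0) (g 0) (Σ n (f ∘ suc)) (Σ n (g ∘ suc)))
  where open +-*-Solver

*-distribˡ-Σ : ∀ n c f → c * Σ n f ≡ Σ n (λ i → c * f i)
*-distribˡ-Σ zero    c f = *-zeroʳ c
*-distribˡ-Σ (suc n) c f = trans (*-distribˡ-+ c (f 0) _) (cong (_+_ (c * f 0)) (*-distribˡ-Σ n c (f ∘ suc)))

Σ-split : ∀ m n f → Σ (m ℕ.+ n) f ≡ Σ m f + Σ n (λ i → f (m ℕ.+ i))
Σ-split zero    n f = sym (+-identityˡ _)
Σ-split (suc m) n f = trans (cong (_+_ (f 0)) (Σ-split m n (f ∘ suc))) (sym (+-assoc (f 0) _ _))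

Σ-last : ∀ n f → Σ (suc n) f ≡ Σ n f + f n
Σ-last zero    f = trans (+-identityʳ (f 0)) (sym (+-identityˡ (f 0)))
Σ-last (suc n) f = trans (cong (_+_ (f 0)) (Σ-last n (f ∘ suc))) (sym (+-assoc (f 0) _ _))

Σ-reverse : ∀ n f → Σ n f ≡ Σ n (λ i → f (n ∸ suc i))
Σ-reverse zero    f = refl
Σ-reverse (suc n) f = begin
  f 0 + Σ n (f ∘ suc)                        ≡⟨ +-comm (f 0) _ ⟩
  Σ n (f ∘ suc) + f 0                        ≡⟨ cong (_+ f 0) (Σ-reverse n (f ∘ suc)) ⟩
  Σ n (λ i → f (suc (n ∸ suc i))) + f 0      ≡⟨ cong₂ _+_ (Σ-cong-< n (λ i i<n → cong f (sym (ℕ.+-∸-assoc 1 i<n)))) (cong f (sym (ℕ.n∸n≡0 n))) ⟩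
  Σ n (λ i → f (suc n ∸ suc i)) + f (n ∸ n)  ≡⟨ Σ-last n (λ i → f (suc n ∸ suc i)) ⟨
  Σ (suc n) (λ i → f (suc n ∸ suc i))        ∎
  where open ≡-Reasoning

Σ-even-odd : ∀ n f → Σ (suc (2 ℕ.* n)) f ≡ Σ (suc n) (λ m → f (2 ℕ.* m)) + Σ n (λ m → f (suc (2 ℕ.* m)))
Σ-even-odd zero    f = sym (+-identityʳ _)
Σ-even-odd (suc n) f = begin
  Σ (suc (2 ℕ.* suc n)) f
    ≡⟨ cong (λ m → Σ (suc m) f) (ℕ.*-suc 2 n) ⟩
  f 0 + (f 1 + Σ (suc (2 ℕ.* n)) (f ∘ suc ∘ suc))
    ≡⟨ cong (λ z → f 0 + (f 1 + z)) (Σ-even-odd n (f ∘ suc ∘ suc)) ⟩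
  f 0 + (f 1 + (Σ (suc n) (λ m → f (2 ℕ.+ 2 ℕ.* m)) + Σ n (λ m → f (3 ℕ.+ 2 ℕ.* m))))
    ≡⟨ cong (λ z → f 0 + (f 1 + z)) (cong₂ _+_ (Σ-cong (suc n) (λ m → cong f (sym (ℕ.*-suc 2 m))))
                                               (Σ-cong n (λ m → cong (f ∘ suc) (sym (ℕ.*-suc 2 m))))) ⟩
  f 0 + (f 1 + (Σ (suc n) (λ m → f (2 ℕ.* suc m)) + Σ n (λ m → f (suc (2 ℕ.* suc m)))))
    ≡⟨ solve 4 (λ a b c d → a :+ (b :+ (c :+ d)) := (a :+ c) :+ (b :+ d)) refl (f 0) (f 1) _ _ ⟩
  Σ (suc (suc n)) (λ m → f (2 ℕ.* m)) + Σ (suc n) (λ m → f (suc (2 ℕ.* m)))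
    ∎
  where
  open ≡-Reasoning
  open +-*-Solver

-- The ring of formal power series over ℚ

infix 4 _≈_
_≈_ : Series → Series → Set
f ≈ g = ∀ k → f k ≡ g k

infixl 6 _+ₛ_
_+ₛ_ : Series → Series → Series
(f +ₛ g) k = f k + g k

-ₛ_ : Series → Series
(-ₛ f) k = - f k

0ₛ : Series
0ₛ _ = 0ℚ

infixr 7 _·_
_·_ : ℚ → Series → Series
(c · f) k = c * f k

shift : Series → Series
shift f k = f (suc k)

+ₛ-cong : ∀ {f f′ g g′} → f ≈ f′ → g ≈ g′ → f +ₛ g ≈ f′ +ₛ g′
+ₛ-cong f≈f′ g≈g′ k = cong₂ _+_ (f≈f′ k) (g≈g′ k)

+ₛ-congˡ : ∀ h {f f′} → f ≈ f′ → h +ₛ f ≈ h +ₛ f′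
+ₛ-congˡ h f≈f′ k = cong (_+_ (h k)) (f≈f′ k)

+ₛ-congʳ : ∀ h {f f′} → f ≈ f′ → f +ₛ h ≈ f′ +ₛ h
+ₛ-congʳ h f≈f′ k = cong (_+ h k) (f≈f′ k)

⊛-coeff : ∀ f g k → (f ⊛ g) k ≡ Σ (suc k) (λ i → f i * g (k ∸ i))
⊛-coeff f g k = sumTo≡Σ k (λ i → f i * g (k ∸ i))

⊛-coeff-zero : ∀ f g → (f ⊛ g) 0 ≡ f 0 * g 0
⊛-coeff-zero f g = +-identityʳ (f 0 * g 0)

shift-⊛ : ∀ f g → shift (f ⊛ g) ≈ f 0 · shift g +ₛ shift f ⊛ g
shift-⊛ f g k = trans (⊛-coeff f g (suc k)) (cong (_+_ (f 0 * g (suc k))) (sym (⊛-coeff (shift f) g k)))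

⊛-cong : ∀ {f f′ g g′} → f ≈ f′ → g ≈ g′ → f ⊛ g ≈ f′ ⊛ g′
⊛-cong {f} {f′} {g} {g′} f≈f′ g≈g′ k = begin
  (f ⊛ g) k                              ≡⟨ ⊛-coeff f g k ⟩
  Σ (suc k) (λ i → f i * g (k ∸ i))      ≡⟨ Σ-cong (suc k) (λ i → cong₂ _*_ (f≈f′ i) (g≈g′ (k ∸ i))) ⟩
  Σ (suc k) (λ i → f′ i * g′ (k ∸ i))    ≡⟨ ⊛-coeff f′ g′ k ⟨
  (f′ ⊛ g′) k                            ∎
  where open ≡-Reasoning

⊛-congˡ : ∀ h {f f′} → f ≈ f′ → h ⊛ f ≈ h ⊛ f′
⊛-congˡ h f≈f′ = ⊛-cong {h} {h} (λ _ → refl) f≈f′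

⊛-congʳ : ∀ h {f f′} → f ≈ f′ → f ⊛ h ≈ f′ ⊛ h
⊛-congʳ h f≈f′ = ⊛-cong {g = h} {h} f≈f′ (λ _ → refl)

⊛-distribˡ-+ : ∀ f g h → f ⊛ (g +ₛ h) ≈ f ⊛ g +ₛ f ⊛ h
⊛-distribˡ-+ f g h k = begin
  (f ⊛ (g +ₛ h)) k                                                        ≡⟨ ⊛-coeff f (g +ₛ h) k ⟩
  Σ (suc k) (λ i → f i * (g (k ∸ i) + h (k ∸ i)))                         ≡⟨ Σ-cong (suc k) (λ i → *-distribˡ-+ (f i) (g (k ∸ i)) (h (k ∸ i))) ⟩
  Σ (suc k) (λ i → f i * g (k ∸ i) + f i * h (k ∸ i))                     ≡⟨ Σ-distrib-+ (suc k) (λ i → f i * g (k ∸ i)) (λ i → f i * h (k ∸ i)) ⟩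
  Σ (suc k) (λ i → f i * g (k ∸ i)) + Σ (suc k) (λ i → f i * h (k ∸ i))   ≡⟨ cong₂ _+_ (⊛-coeff f g k) (⊛-coeff f h k) ⟨
  (f ⊛ g) k + (f ⊛ h) k                                                   ∎
  where open ≡-Reasoning

⊛-comm : ∀ f g → f ⊛ g ≈ g ⊛ f
⊛-comm f g k = begin
  (f ⊛ g) k
    ≡⟨ ⊛-coeff f g k ⟩
  Σ (suc k) (λ i → f i * g (k ∸ i))
    ≡⟨ Σ-reverse (suc k) (λ i → f i * g (k ∸ i)) ⟩
  Σ (suc k) (λ i → f (k ∸ i) * g (k ∸ (k ∸ i)))
    ≡⟨ Σ-cong-< (suc k) {g = λ i → g i * f (k ∸ i)}
          (λ i i≤k → trans (*-comm (f (k ∸ i)) (g (k ∸ (k ∸ i)))) (cong (λ j → g j * f (k ∸ i)) (ℕ.m∸[m∸n]≡n (ℕ.≤-pred i≤k)))) ⟩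
  Σ (suc k) (λ i → g i * f (k ∸ i))
    ≡⟨ ⊛-coeff g f k ⟨
  (g ⊛ f) k                                           ∎
  where open ≡-Reasoning

⊛-distribʳ-+ : ∀ f g h → (g +ₛ h) ⊛ f ≈ g ⊛ f +ₛ h ⊛ f
⊛-distribʳ-+ f g h k = trans (⊛-comm (g +ₛ h) f k) (trans (⊛-distribˡ-+ f g h k) (cong₂ _+_ (⊛-comm f g k) (⊛-comm f h k)))

⊛-constantˡ : ∀ c f → (∀ i → c (suc i) ≡ 0ℚ) → c ⊛ f ≈ c 0 · f
⊛-constantˡ c f c-const k = begin
  (c ⊛ f) k
    ≡⟨ ⊛-coeff c f k ⟩
  c 0 * f k + Σ k (λ i → c (suc i) * f (k ∸ suc i))
    ≡⟨ cong (_+_ (c 0 * f k)) (Σ-cong k (λ i → trans (cong (_* f (k ∸ suc i)) (c-const i)) (*-zeroˡ (f (k ∸ suc i))))) ⟩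
  c 0 * f k + Σ k (λ _ → 0ℚ)
    ≡⟨ cong (_+_ (c 0 * f k)) (Σ-zero k) ⟩
  c 0 * f k + 0ℚ
    ≡⟨ +-identityʳ _ ⟩
  c 0 * f k                                             ∎
  where open ≡-Reasoning

⊛-identityˡ : ∀ f → oneS ⊛ f ≈ f
⊛-identityˡ f k = trans (⊛-constantˡ oneS f (λ _ → refl) k) (*-identityˡ (f k))

⊛-identityʳ : ∀ f → f ⊛ oneS ≈ f
⊛-identityʳ f k = trans (⊛-comm f oneS k) (⊛-identityˡ f k)

·-⊛ : ∀ c f g → (c · f) ⊛ g ≈ c · (f ⊛ g)
·-⊛ c f g k = begin
  ((c · f) ⊛ g) k                               ≡⟨ ⊛-coeff (c · f) g k ⟩
  Σ (suc k) (λ i → c * f i * g (k ∸ i))         ≡⟨ Σ-cong (suc k) (λ i → *-assoc c (f i) (g (k ∸ i))) ⟩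
  Σ (suc k) (λ i → c * (f i * g (k ∸ i)))       ≡⟨ *-distribˡ-Σ (suc k) c (λ i → f i * g (k ∸ i)) ⟨
  c * Σ (suc k) (λ i → f i * g (k ∸ i))         ≡⟨ cong (_*_ c) (⊛-coeff f g k) ⟨
  c * (f ⊛ g) k                                 ∎
  where open ≡-Reasoning

-- Induction on the index; shift-⊛ splits off the constant term of the left factor.
⊛-assoc : ∀ f g h → (f ⊛ g) ⊛ h ≈ f ⊛ (g ⊛ h)
⊛-assoc f g h zero = begin
  ((f ⊛ g) ⊛ h) 0      ≡⟨ trans (⊛-coeff-zero (f ⊛ g) h) (cong (_* h 0) (⊛-coeff-zero f g)) ⟩
  f 0 * g 0 * h 0      ≡⟨ *-assoc (f 0) (g 0) (h 0) ⟩
  f 0 * (g 0 * h 0)    ≡⟨ trans (⊛-coeff-zero f (g ⊛ h)) (cong (_*_ (f 0)) (⊛-coeff-zero g h)) ⟨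
  (f ⊛ (g ⊛ h)) 0      ∎
  where open ≡-Reasoning
⊛-assoc f g h (suc k) = begin
  ((f ⊛ g) ⊛ h) (suc k)
    ≡⟨ shift-⊛ (f ⊛ g) h k ⟩
  (f ⊛ g) 0 * h (suc k) + (shift (f ⊛ g) ⊛ h) k
    ≡⟨ cong₂ _+_ (cong (_* h (suc k)) (⊛-coeff-zero f g)) (⊛-congʳ h (shift-⊛ f g) k) ⟩
  f 0 * g 0 * h (suc k) + ((f 0 · shift g +ₛ shift f ⊛ g) ⊛ h) k
    ≡⟨ cong (_+_ (f 0 * g 0 * h (suc k))) (trans (⊛-distribʳ-+ h (f 0 · shift g) (shift f ⊛ g) k)
         (cong₂ _+_ (·-⊛ (f 0) (shift g) h k) (⊛-assoc (shift f) g h k))) ⟩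
  f 0 * g 0 * h (suc k) + (f 0 * (shift g ⊛ h) k + (shift f ⊛ (g ⊛ h)) k)
    ≡⟨ solve 5 (λ a b c x y → a :* b :* c :+ (a :* x :+ y) := a :* (b :* c :+ x) :+ y) refl (f 0) (g 0) (h (suc k)) _ _ ⟩
  f 0 * (g 0 * h (suc k) + (shift g ⊛ h) k) + (shift f ⊛ (g ⊛ h)) k
    ≡⟨ cong (λ z → f 0 * z + (shift f ⊛ (g ⊛ h)) k) (shift-⊛ g h k) ⟨
  f 0 * (g ⊛ h) (suc k) + (shift f ⊛ (g ⊛ h)) k
    ≡⟨ shift-⊛ f (g ⊛ h) k ⟨
  (f ⊛ (g ⊛ h)) (suc k) ∎
  where
  open ≡-Reasoning
  open +-*-Solver

seriesCR : CommutativeRing 0ℓ 0ℓ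
seriesCR = record
  { Carrier = Series ; _≈_ = _≈_ ; _+_ = _+ₛ_ ; _*_ = _⊛_ ; -_ = -ₛ_ ; 0# = 0ₛ ; 1# = oneS
  ; isCommutativeRing = record
    { isRing = record
      { +-isAbelianGroup = record
        { isGroup = record
          { isMonoid = record
            { isSemigroup = record
              { isMagma = record
                { isEquivalence = record { refl = λ _ → refl ; sym = λ p k → sym (p k) ; trans = λ p q k → trans (p k) (q k) }
                ; ∙-cong = λ p q k → cong₂ _+_ (p k) (q k) }
              ; assoc = λ f g h k → +-assoc (f k) (g k) (h k) }
            ; identity = (λ f k → +-identityˡ (f k)) , (λ f k → +-identityʳ (f k)) }
          ; inverse = (λ f k → +-inverseˡ (f k)) , (λ f k → +-inverseʳ (f k))
          ; ⁻¹-cong = λ p k → cong -_ (p k) }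
        ; comm = λ f g k → +-comm (f k) (g k) }
      ; *-cong = ⊛-cong
      ; *-assoc = ⊛-assoc
      ; *-identity = ⊛-identityˡ , ⊛-identityʳ
      ; distrib = ⊛-distribˡ-+ , ⊛-distribʳ-+ }
    ; *-comm = ⊛-comm } }

κ : ℚ → Series
κ c zero    = c
κ c (suc _) = 0ℚ

κ-⊛ : ∀ c f → κ c ⊛ f ≈ c · f
κ-⊛ c f = ⊛-constantˡ (κ c) f (λ _ → refl)

ℚ-rawRing : RawRing 0ℓ 0ℓ
ℚ-rawRing = CommutativeRing.rawRing +-*-commutativeRing

κ-+ : ∀ a b → κ (a + b) ≈ κ a +ₛ κ b
κ-+ a b zero    = refl
κ-+ a b (suc _) = refl

κ-* : ∀ a b → κ (a * b) ≈ κ a ⊛ κ b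
κ-* a b zero    = sym (κ-⊛ a (κ b) 0)
κ-* a b (suc k) = sym (trans (κ-⊛ a (κ b) (suc k)) (*-zeroʳ a))

κ-1 : κ 1ℚ ≈ oneS
κ-1 zero    = refl
κ-1 (suc _) = refl

κ-morphism : ℚ-rawRing -Raw-AlmostCommutative⟶ fromCommutativeRing seriesCR
κ-morphism = record
  { ⟦_⟧ = κ
  ; +-homo = κ-+
  ; *-homo = κ-*
  ; -‿homo = λ { a zero → refl ; a (suc _) → refl }
  ; 0-homo = λ { zero → refl ; (suc _) → refl }
  ; 1-homo = κ-1 }

κ-≟ : ∀ a b → Maybe (κ a ≈ κ b)
κ-≟ a b with a ≟ b
... | yes refl = just (λ _ → refl)
... | no _     = nothing

-- Ring solver for series with rational constants, where con c denotes κ c. As κ 1ℚ is not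
-- definitionally oneS, identities meant for the solver are stated with κ 1ℚ.
module Series-Solver = Algebra.Solver.Ring ℚ-rawRing (fromCommutativeRing seriesCR) κ-morphism κ-≟

open import Algebra.Properties.CommutativeSemiring.Exp (CommutativeRing.commutativeSemiring seriesCR) as Series-Exp
  using () renaming (_^_ to _^ₛ_)

module ≈-Reasoning = Relation.Binary.Reasoning.Setoid (CommutativeRing.setoid seriesCR)

-ₛ-^ : ∀ f n → (-ₛ f) ^ₛ n ≈ κ ((- 1ℚ) ^ℚ n) ⊛ (f ^ₛ n)
-ₛ-^ f zero    k = sym (trans (κ-⊛ 1ℚ oneS k) (*-identityˡ (oneS k)))
-ₛ-^ f (suc n) = begin
  (-ₛ f) ⊛ ((-ₛ f) ^ₛ n)
    ≈⟨ ⊛-congˡ (-ₛ f) (-ₛ-^ f n) ⟩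
  (-ₛ f) ⊛ (κ c ⊛ (f ^ₛ n))
    ≈⟨ solve 3 (λ f c fn → (:- f) :* (c :* fn) := (con (- 1ℚ) :* c) :* (f :* fn)) (λ _ → refl) f (κ c) (f ^ₛ n) ⟩
  (κ (- 1ℚ) ⊛ κ c) ⊛ (f ^ₛ suc n)
    ≈⟨ ⊛-congʳ (f ^ₛ suc n) (λ k → sym (κ-* (- 1ℚ) c k)) ⟩
  κ ((- 1ℚ) ^ℚ suc n) ⊛ (f ^ₛ suc n)              ∎
  where
  c = (- 1ℚ) ^ℚ n
  open ≈-Reasoning
  open Series-Solver

κ-^ : ∀ a n → κ a ^ₛ n ≈ κ (a ^ℚ n)
κ-^ a zero    k = sym (κ-1 k)
κ-^ a (suc n) k = trans (⊛-congˡ (κ a) (κ-^ a n) k) (sym (κ-* a (a ^ℚ n) k))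

^S≈^ₛ : ∀ f n → f ^S n ≈ f ^ₛ n
^S≈^ₛ f zero    _ = refl
^S≈^ₛ f (suc n)   = ⊛-congˡ f (^S≈^ₛ f n)

^S-coeff-zero : ∀ f n → f 0 ≡ 1ℚ → (f ^S n) 0 ≡ 1ℚ
^S-coeff-zero f zero    f0≡1 = refl
^S-coeff-zero f (suc n) f0≡1 = trans (⊛-coeff-zero f (f ^S n)) (trans (cong₂ _*_ f0≡1 (^S-coeff-zero f n f0≡1)) (*-identityˡ 1ℚ))

-- The variable X, the Euler operator θ = x d/dx, exponentials and reciprocals

X : Series
X zero          = 0ℚ
X (suc zero)    = 1ℚ
X (suc (suc _)) = 0ℚ

X-⊛-zero : ∀ f → (X ⊛ f) 0 ≡ 0ℚ
X-⊛-zero f = trans (⊛-coeff-zero X f) (*-zeroˡ (f 0))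

X-⊛-suc : ∀ f k → (X ⊛ f) (suc k) ≡ f k
X-⊛-suc f k = begin
  (X ⊛ f) (suc k)                    ≡⟨ shift-⊛ X f k ⟩
  0ℚ * f (suc k) + (shift X ⊛ f) k   ≡⟨ cong₂ _+_ (*-zeroˡ (f (suc k))) (⊛-congʳ f shift-X k) ⟩
  0ℚ + (oneS ⊛ f) k                  ≡⟨ trans (+-identityˡ _) (⊛-identityˡ f k) ⟩
  f k                                ∎
  where
  open ≡-Reasoning
  shift-X : shift X ≈ oneS
  shift-X zero    = refl
  shift-X (suc _) = refl

X-⊛-cancel : ∀ {f g} → X ⊛ f ≈ X ⊛ g → f ≈ g
X-⊛-cancel {f} {g} eq k = trans (sym (X-⊛-suc f k)) (trans (eq (suc k)) (X-⊛-suc g k))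

X-⊛-shift : ∀ f → f 0 ≡ 0ℚ → X ⊛ shift f ≈ f
X-⊛-shift f f0≡0 zero    = trans (X-⊛-zero (shift f)) (sym f0≡0)
X-⊛-shift f f0≡0 (suc k) = X-⊛-suc (shift f) k

X^-⊛-below : ∀ m f {j} → j ℕ.< m → ((X ^ₛ m) ⊛ f) j ≡ 0ℚ
X^-⊛-below (suc m) f {zero}  _ = trans (⊛-assoc X (X ^ₛ m) f 0) (X-⊛-zero ((X ^ₛ m) ⊛ f))
X^-⊛-below (suc m) f {suc j} (ℕ.s≤s j<m) =
  trans (⊛-assoc X (X ^ₛ m) f (suc j)) (trans (X-⊛-suc ((X ^ₛ m) ⊛ f) j) (X^-⊛-below m f j<m))

θ : Series → Series
θ f k = ℕ→ℚ k * f k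

θ-cong : ∀ {f g} → f ≈ g → θ f ≈ θ g
θ-cong f≈g k = cong (_*_ (ℕ→ℚ k)) (f≈g k)

θ-+ : ∀ f g → θ (f +ₛ g) ≈ θ f +ₛ θ g
θ-+ f g k = *-distribˡ-+ (ℕ→ℚ k) (f k) (g k)

θ-neg : ∀ f → θ (-ₛ f) ≈ -ₛ θ f
θ-neg f k = sym (neg-distribʳ-* (ℕ→ℚ k) (f k))

θ-κ : ∀ c → θ (κ c) ≈ κ 0ℚ
θ-κ c zero    = *-zeroˡ c
θ-κ c (suc k) = *-zeroʳ (ℕ→ℚ (suc k))

θ-X : θ X ≈ X
θ-X zero          = refl
θ-X (suc zero)    = refl
θ-X (suc (suc k)) = *-zeroʳ (ℕ→ℚ (suc (suc k)))

θ-⊛ : ∀ f g → θ (f ⊛ g) ≈ θ f ⊛ g +ₛ f ⊛ θ g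
θ-⊛ f g k = begin
  ℕ→ℚ k * (f ⊛ g) k
    ≡⟨ cong (_*_ (ℕ→ℚ k)) (⊛-coeff f g k) ⟩
  ℕ→ℚ k * Σ (suc k) (λ i → f i * g (k ∸ i))
    ≡⟨ *-distribˡ-Σ (suc k) (ℕ→ℚ k) (λ i → f i * g (k ∸ i)) ⟩
  Σ (suc k) (λ i → ℕ→ℚ k * (f i * g (k ∸ i)))
    ≡⟨ Σ-cong-< (suc k) (λ i i≤k → split i (ℕ.≤-pred i≤k)) ⟩
  Σ (suc k) (λ i → θ f i * g (k ∸ i) + f i * θ g (k ∸ i))
    ≡⟨ Σ-distrib-+ (suc k) (λ i → θ f i * g (k ∸ i)) (λ i → f i * θ g (k ∸ i)) ⟩
  Σ (suc k) (λ i → θ f i * g (k ∸ i)) + Σ (suc k) (λ i → f i * θ g (k ∸ i))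
    ≡⟨ cong₂ _+_ (⊛-coeff (θ f) g k) (⊛-coeff f (θ g) k) ⟨
  (θ f ⊛ g) k + (f ⊛ θ g) k
    ∎
  where
  open ≡-Reasoning
  split : ∀ i → i ℕ.≤ k → ℕ→ℚ k * (f i * g (k ∸ i)) ≡ θ f i * g (k ∸ i) + f i * θ g (k ∸ i)
  split i i≤k = begin
    ℕ→ℚ k * (f i * g (k ∸ i))
      ≡⟨ cong (λ n → ℕ→ℚ n * (f i * g (k ∸ i))) (ℕ.m+[n∸m]≡n i≤k) ⟨
    ℕ→ℚ (i ℕ.+ (k ∸ i)) * (f i * g (k ∸ i))
      ≡⟨ cong (_* (f i * g (k ∸ i))) (ℕ→ℚ-homo-+ i (k ∸ i)) ⟩
    (ℕ→ℚ i + ℕ→ℚ (k ∸ i)) * (f i * g (k ∸ i))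
      ≡⟨ solve 4 (λ m n x y → (m :+ n) :* (x :* y) := m :* x :* y :+ x :* (n :* y)) refl (ℕ→ℚ i) (ℕ→ℚ (k ∸ i)) (f i) (g (k ∸ i)) ⟩
    θ f i * g (k ∸ i) + f i * θ g (k ∸ i)          ∎
    where open +-*-Solver

θ-^ : ∀ f m → θ (f ^ₛ suc m) ≈ κ (ℕ→ℚ (suc m)) ⊛ ((f ^ₛ m) ⊛ θ f)
θ-^ f zero k = begin
  θ (f ⊛ oneS) k                      ≡⟨ θ-cong (⊛-identityʳ f) k ⟩
  θ f k                               ≡⟨ trans (*-identityˡ ((oneS ⊛ θ f) k)) (⊛-identityˡ (θ f) k) ⟨
  1ℚ * (oneS ⊛ θ f) k                 ≡⟨ κ-⊛ 1ℚ (oneS ⊛ θ f) k ⟨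
  (κ 1ℚ ⊛ (oneS ⊛ θ f)) k             ∎
  where open ≡-Reasoning
θ-^ f (suc m) = begin
  θ (f ⊛ (f ^ₛ suc m))
    ≈⟨ θ-⊛ f (f ^ₛ suc m) ⟩
  θ f ⊛ (f ^ₛ suc m) +ₛ f ⊛ θ (f ^ₛ suc m)
    ≈⟨ +ₛ-congˡ (θ f ⊛ (f ^ₛ suc m)) (⊛-congˡ f (θ-^ f m)) ⟩
  θ f ⊛ (f ^ₛ suc m) +ₛ f ⊛ (κ (ℕ→ℚ (suc m)) ⊛ ((f ^ₛ m) ⊛ θ f))
    ≈⟨ solve 4 (λ t f fm c → t :* (f :* fm) :+ f :* (c :* (fm :* t))
        := (con 1ℚ :+ c) :* ((f :* fm) :* t))
        (λ _ → refl) (θ f) f (f ^ₛ m) (κ (ℕ→ℚ (suc m))) ⟩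
  (κ 1ℚ +ₛ κ (ℕ→ℚ (suc m))) ⊛ ((f ^ₛ suc m) ⊛ θ f)
    ≈⟨ ⊛-congʳ ((f ^ₛ suc m) ⊛ θ f) (λ i → trans (sym (κ-+ 1ℚ (ℕ→ℚ (suc m)) i)) (cong (λ c → κ c i) (sym (ℕ→ℚ-suc (suc m))))) ⟩
  κ (ℕ→ℚ (suc (suc m))) ⊛ ((f ^ₛ suc m) ⊛ θ f)
    ∎
  where
  open ≈-Reasoning
  open Series-Solver

θ-^-coeff : ∀ f m j → ℕ→ℚ (suc m) * ((f ^ₛ m) ⊛ θ f) j ≡ ℕ→ℚ j * (f ^ₛ suc m) j
θ-^-coeff f m j = sym (trans (θ-^ f m j) (κ-⊛ (ℕ→ℚ (suc m)) ((f ^ₛ m) ⊛ θ f) j))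

θ-^-coeff-diag : ∀ f m → ((f ^ₛ m) ⊛ θ f) (suc m) ≡ (f ^ₛ suc m) (suc m)
θ-^-coeff-diag f m = *-cancelˡ-ℕ→ℚ-suc m (θ-^-coeff f m (suc m))

θ-recip : ∀ {f g} → f ⊛ g ≈ κ 1ℚ → θ g ≈ -ₛ ((g ⊛ g) ⊛ θ f)
θ-recip {f} {g} fg≈1 = begin
  θ g
    ≈⟨ solve 1 (λ θg → θg := θg :* con 1ℚ) (λ _ → refl) (θ g) ⟩
  θ g ⊛ κ 1ℚ
    ≈⟨ ⊛-congˡ (θ g) (λ k → sym (fg≈1 k)) ⟩
  θ g ⊛ (f ⊛ g)
    ≈⟨ solve 4 (λ f g θf θg → θg :* (f :* g) := g :* (θf :* g :+ f :* θg) :- g :* g :* θf) (λ _ → refl) f g (θ f) (θ g) ⟩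
  g ⊛ (θ f ⊛ g +ₛ f ⊛ θ g) +ₛ -ₛ ((g ⊛ g) ⊛ θ f)
    ≈⟨ +ₛ-congʳ (-ₛ ((g ⊛ g) ⊛ θ f)) (⊛-congˡ g (λ k → trans (sym (θ-⊛ f g k)) (trans (θ-cong fg≈1 k) (θ-κ 1ℚ k)))) ⟩
  g ⊛ κ 0ℚ +ₛ -ₛ ((g ⊛ g) ⊛ θ f)
    ≈⟨ solve 3 (λ g θf x → g :* con 0ℚ :+ x := x) (λ _ → refl) g (θ f) (-ₛ ((g ⊛ g) ⊛ θ f)) ⟩
  -ₛ ((g ⊛ g) ⊛ θ f)                                    ∎
  where
  open ≈-Reasoning
  open Series-Solver

E : ℚ → Series
E a k = a ^ℚ k * invFact k

θ-coeff-suc : ∀ {F} a → θ F ≈ κ a ⊛ (X ⊛ F) → ∀ k → ℕ→ℚ (suc k) * F (suc k) ≡ a * F k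
θ-coeff-suc {F} a θF≈ k = trans (θF≈ (suc k)) (trans (κ-⊛ a (X ⊛ F) (suc k)) (cong (_*_ a) (X-⊛-suc F k)))

θ-E : ∀ a → θ (E a) ≈ κ a ⊛ (X ⊛ E a)
θ-E a zero    = trans (*-zeroˡ (E a 0)) (sym (trans (κ-⊛ a (X ⊛ E a) 0) (trans (cong (_*_ a) (X-⊛-zero (E a))) (*-zeroʳ a))))
θ-E a (suc k) = begin
  ℕ→ℚ (suc k) * (a * a ^ℚ k * invFact (suc k))
    ≡⟨ solve 4 (λ n a p i → n :* (a :* p :* i) := a :* (p :* (i :* n))) refl (ℕ→ℚ (suc k)) a (a ^ℚ k) (invFact (suc k)) ⟩
  a * (a ^ℚ k * (invFact (suc k) * ℕ→ℚ (suc k)))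
    ≡⟨ cong (λ i → a * (a ^ℚ k * i)) (invFact-suc k) ⟩
  a * E a k
    ≡⟨ cong (_*_ a) (X-⊛-suc (E a) k) ⟨
  a * (X ⊛ E a) (suc k)
    ≡⟨ κ-⊛ a (X ⊛ E a) (suc k) ⟨
  (κ a ⊛ (X ⊛ E a)) (suc k)                         ∎
  where
  open ≡-Reasoning
  open +-*-Solver

E-unique : ∀ a {F} → F 0 ≡ 1ℚ → θ F ≈ κ a ⊛ (X ⊛ F) → F ≈ E a
E-unique a F0≡1 θF≈ zero    = F0≡1
E-unique a F0≡1 θF≈ (suc k) = *-cancelˡ-ℕ→ℚ-suc k (begin
  ℕ→ℚ (suc k) * _            ≡⟨ θ-coeff-suc a θF≈ k ⟩
  a * _                      ≡⟨ cong (_*_ a) (E-unique a F0≡1 θF≈ k) ⟩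
  a * E a k                  ≡⟨ θ-coeff-suc a (θ-E a) k ⟨
  ℕ→ℚ (suc k) * E a (suc k)  ∎)
  where open ≡-Reasoning

E-+ : ∀ a b → E a ⊛ E b ≈ E (a + b)
E-+ a b = E-unique (a + b) (⊛-coeff-zero (E a) (E b)) (begin
  θ (E a ⊛ E b)
    ≈⟨ θ-⊛ (E a) (E b) ⟩
  θ (E a) ⊛ E b +ₛ E a ⊛ θ (E b)
    ≈⟨ +ₛ-cong (⊛-congʳ (E b) (θ-E a)) (⊛-congˡ (E a) (θ-E b)) ⟩
  (κ a ⊛ (X ⊛ E a)) ⊛ E b +ₛ E a ⊛ (κ b ⊛ (X ⊛ E b))
    ≈⟨ solve 5 (λ ka kb x ea eb → ka :* (x :* ea) :* eb :+ ea :* (kb :* (x :* eb))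
        := (ka :+ kb) :* (x :* (ea :* eb)))
        (λ _ → refl) (κ a) (κ b) X (E a) (E b) ⟩
  (κ a +ₛ κ b) ⊛ (X ⊛ (E a ⊛ E b))
    ≈⟨ ⊛-congʳ (X ⊛ (E a ⊛ E b)) (λ k → sym (κ-+ a b k)) ⟩
  κ (a + b) ⊛ (X ⊛ (E a ⊛ E b))                              ∎)
  where
  open ≈-Reasoning
  open Series-Solver

E-0 : E 0ℚ ≈ κ 1ℚ
E-0 zero    = refl
E-0 (suc k) = trans (cong (_* invFact (suc k)) (*-zeroˡ (0ℚ ^ℚ k))) (*-zeroˡ (invFact (suc k)))

E-cong : ∀ {a b} → a ≡ b → E a ≈ E b
E-cong refl _ = refl

E-^ : ∀ a n → E a ^ₛ n ≈ E (ℕ→ℚ n * a)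
E-^ a zero    k = sym (trans (E-cong (*-zeroˡ a) k) (trans (E-0 k) (κ-1 k)))
E-^ a (suc n) k = begin
  (E a ⊛ (E a ^ₛ n)) k            ≡⟨ ⊛-congˡ (E a) (E-^ a n) k ⟩
  (E a ⊛ E (ℕ→ℚ n * a)) k         ≡⟨ E-+ a (ℕ→ℚ n * a) k ⟩
  E (a + ℕ→ℚ n * a) k             ≡⟨ E-cong (solve 2 (λ a n → a :+ n :* a := (con 1ℚ :+ n) :* a) refl a (ℕ→ℚ n)) k ⟩
  E ((1ℚ + ℕ→ℚ n) * a) k          ≡⟨ E-cong (cong (_* a) (ℕ→ℚ-suc n)) k ⟨
  E (ℕ→ℚ (suc n) * a) k           ∎
  where
  open ≡-Reasoning
  open +-*-Solver

E-neg-even : ∀ a l → E (- a) (2 ℕ.* l) ≡ E a (2 ℕ.* l)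
E-neg-even a l = cong (_* invFact (2 ℕ.* l))
  (trans (neg-^ a (2 ℕ.* l)) (trans (cong (_* a ^ℚ (2 ℕ.* l)) (-1^-even l)) (*-identityˡ (a ^ℚ (2 ℕ.* l)))))

E-neg-odd : ∀ a l → E (- a) (suc (2 ℕ.* l)) ≡ - E a (suc (2 ℕ.* l))
E-neg-odd a l = begin
  (- a) ^ℚ suc (2 ℕ.* l) * invFact (suc (2 ℕ.* l))
    ≡⟨ cong (_* invFact (suc (2 ℕ.* l))) (neg-^ a (suc (2 ℕ.* l))) ⟩
  - 1ℚ * (- 1ℚ) ^ℚ (2 ℕ.* l) * a ^ℚ suc (2 ℕ.* l) * invFact (suc (2 ℕ.* l))
    ≡⟨ cong (λ s → - 1ℚ * s * a ^ℚ suc (2 ℕ.* l) * invFact (suc (2 ℕ.* l))) (-1^-even l) ⟩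
  - 1ℚ * 1ℚ * a ^ℚ suc (2 ℕ.* l) * invFact (suc (2 ℕ.* l))
    ≡⟨ solve 2 (λ p i → :- con 1ℚ :* con 1ℚ :* p :* i := :- (p :* i)) refl (a ^ℚ suc (2 ℕ.* l)) (invFact (suc (2 ℕ.* l))) ⟩
  - E a (suc (2 ℕ.* l))                                                  ∎
  where
  open ≡-Reasoning
  open +-*-Solver

recip1-suc : ∀ f n → recip1 f (suc n) ≡ - Σ (suc n) (λ i → f (suc i) * recip1 f (n ∸ i))
recip1-suc f n = cong -_ (begin
  foldr _+_ 0ℚ (zipWith _*_ (map (f ∘ suc) (applyUpTo id (suc n))) (recipList f n))
    ≡⟨ cong₂ (λ xs ys → foldr _+_ 0ℚ (zipWith _*_ xs ys)) (map-applyUpTo (f ∘ suc) id (suc n)) (recipList≡ n) ⟩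
  foldr _+_ 0ℚ (zipWith _*_ (applyUpTo (f ∘ suc) (suc n)) (applyUpTo (λ i → recip1 f (n ∸ i)) (suc n)))
    ≡⟨ foldr-zipWith (f ∘ suc) (λ i → recip1 f (n ∸ i)) (suc n) ⟩
  Σ (suc n) (λ i → f (suc i) * recip1 f (n ∸ i))
    ∎)
  where
  open ≡-Reasoning
  recipList≡ : ∀ m → recipList f m ≡ applyUpTo (λ i → recip1 f (m ∸ i)) (suc m)
  recipList≡ zero    = refl
  recipList≡ (suc m) = cong (recip1 f (suc m) ∷_) (recipList≡ m)
  map-applyUpTo : ∀ (φ : ℕ → ℚ) ψ m → map φ (applyUpTo ψ m) ≡ applyUpTo (φ ∘ ψ) m
  map-applyUpTo φ ψ zero    = refl
  map-applyUpTo φ ψ (suc m) = cong (φ (ψ 0) ∷_) (map-applyUpTo φ (ψ ∘ suc) m)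
  foldr-zipWith : ∀ g h m → foldr _+_ 0ℚ (zipWith _*_ (applyUpTo g m) (applyUpTo h m)) ≡ Σ m (λ i → g i * h i)
  foldr-zipWith g h zero    = refl
  foldr-zipWith g h (suc m) = cong (_+_ (g 0 * h 0)) (foldr-zipWith (g ∘ suc) (h ∘ suc) m)

⊛-recip1 : ∀ f → f 0 ≡ 1ℚ → f ⊛ recip1 f ≈ oneS
⊛-recip1 f f0≡1 zero    = trans (⊛-coeff-zero f (recip1 f)) (cong (_* 1ℚ) f0≡1)
⊛-recip1 f f0≡1 (suc n) = begin
  (f ⊛ recip1 f) (suc n)                      ≡⟨ shift-⊛ f (recip1 f) n ⟩
  f 0 * recip1 f (suc n) + (shift f ⊛ recip1 f) n
    ≡⟨ cong₂ _+_ (trans (cong₂ _*_ f0≡1 (recip1-suc f n)) (*-identityˡ (- S))) (⊛-coeff (shift f) (recip1 f) n) ⟩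
  - S + S                                     ≡⟨ +-inverseˡ S ⟩
  0ℚ                                          ∎
  where
  open ≡-Reasoning
  S = Σ (suc n) (λ i → f (suc i) * recip1 f (n ∸ i))

-- Hyperbolic functions at x/2 and the Riccati equation

½ ¼ : ℚ
½ = + 1 / 2
¼ = + 1 / 4

-- 1 for even j and 0 for odd j; evenIndicator j / (j+1)! is the coefficient of x^(j+1) in sinh x.
evenIndicator : ℕ → ℚ
evenIndicator j = ½ * (1ℚ ^ℚ suc j + - (- 1ℚ) ^ℚ suc j)

evenIndicator-suc-suc : ∀ j → evenIndicator (suc (suc j)) ≡ evenIndicator j
evenIndicator-suc-suc j = solve 2 (λ p m → con ½ :* (con 1ℚ :* (con 1ℚ :* p) :+ :- ((:- con 1ℚ) :* ((:- con 1ℚ) :* m))) := con ½ :* (p :+ :- m))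
  refl (1ℚ ^ℚ suc j) ((- 1ℚ) ^ℚ suc j)
  where open +-*-Solver

2-periodic : ∀ (g : ℕ → ℚ) c → g 0 ≡ c → g 1 ≡ 0ℚ → (∀ j → g (suc (suc j)) ≡ g j) → ∀ j → g j ≡ evenIndicator j * c
2-periodic g c g0 g1 g2 zero          = trans g0 (sym (*-identityˡ c))
2-periodic g c g0 g1 g2 (suc zero)    = trans g1 (sym (*-zeroˡ c))
2-periodic g c g0 g1 g2 (suc (suc j)) = trans (g2 j) (trans (2-periodic g c g0 g1 g2 j) (cong (_* c) (sym (evenIndicator-suc-suc j))))

-- Defs.sinhc computes its coefficients by a where-bound helper that cannot be named. At index
-- m+4, with-abstracting suc (suc m) leaves that helper applied to independent variables, so the
-- metavariable sinhcTail is solved to it by unification.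
mutual
  sinhcTail : ℕ → ℕ → ℚ
  sinhcTail = _
  sinhc≡sinhcTail : ∀ m → sinhc (suc (suc (suc (suc m)))) ≡ sinhcTail (suc (suc m)) m
  sinhc≡sinhcTail m with suc (suc m)
  ... | n = refl

sinhc-coeff : ∀ k → sinhc k ≡ evenIndicator k * invFact (suc k)
sinhc-coeff 0 = refl
sinhc-coeff 1 = refl
sinhc-coeff 2 = refl
sinhc-coeff 3 = refl
sinhc-coeff (suc (suc (suc (suc m)))) = begin
  sinhc (suc (suc (suc (suc m))))
    ≡⟨ sinhc≡sinhcTail m ⟩
  sinhcTail (suc (suc m)) m
    ≡⟨ 2-periodic (sinhcTail (suc (suc m))) _ refl refl (λ _ → refl) m ⟩
  evenIndicator m * invFact (suc (suc (suc (suc (suc m)))))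
    ≡⟨ cong (_* invFact (suc (suc (suc (suc (suc m)))))) (trans (evenIndicator-suc-suc (suc (suc m))) (evenIndicator-suc-suc m)) ⟨
  evenIndicator (suc (suc (suc (suc m)))) * invFact (suc (suc (suc (suc (suc m))))) ∎
  where open ≡-Reasoning

-- e₊, e₋ = exp(±x/2); twoSinh½ = 2 sinh(x/2), cosh½ = cosh(x/2), sinhc½ = sinh(x/2) / (x/2).
e₊ e₋ : Series
e₊ = E ½
e₋ = E (- ½)

e₊⊛e₋ : e₊ ⊛ e₋ ≈ κ 1ℚ
e₊⊛e₋ k = trans (E-+ ½ (- ½) k) (E-0 k)

e₊⊛e₊ : e₊ ⊛ e₊ ≈ E 1ℚ
e₊⊛e₊ = E-+ ½ ½

e₋⊛e₋ : e₋ ⊛ e₋ ≈ E (- 1ℚ)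
e₋⊛e₋ = E-+ (- ½) (- ½)

twoSinh½ cosh½ sinhc½ : Series
twoSinh½ = e₊ +ₛ -ₛ e₋
cosh½    = κ ½ ⊛ (e₊ +ₛ e₋)
sinhc½   = shift twoSinh½

X⊛sinhc½ : X ⊛ sinhc½ ≈ twoSinh½
X⊛sinhc½ = X-⊛-shift twoSinh½ refl

X⊛sinhc : X ⊛ sinhc ≈ κ ½ ⊛ (E 1ℚ +ₛ -ₛ E (- 1ℚ))
X⊛sinhc zero    = trans (X-⊛-zero sinhc) (sym (κ-⊛ ½ (E 1ℚ +ₛ -ₛ E (- 1ℚ)) 0))
X⊛sinhc (suc k) = begin
  (X ⊛ sinhc) (suc k)
    ≡⟨ X-⊛-suc sinhc k ⟩
  sinhc k
    ≡⟨ sinhc-coeff k ⟩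
  evenIndicator k * invFact (suc k)
    ≡⟨ solve 4 (λ h p m i → h :* (p :+ :- m) :* i := h :* (p :* i :+ :- (m :* i))) refl ½ (1ℚ ^ℚ suc k) ((- 1ℚ) ^ℚ suc k) (invFact (suc k)) ⟩
  ½ * (E 1ℚ (suc k) + - E (- 1ℚ) (suc k))
    ≡⟨ κ-⊛ ½ (E 1ℚ +ₛ -ₛ E (- 1ℚ)) (suc k) ⟨
  (κ ½ ⊛ (E 1ℚ +ₛ -ₛ E (- 1ℚ))) (suc k)        ∎
  where
  open ≡-Reasoning
  open +-*-Solver

sinhc≈sinhc½⊛cosh½ : sinhc ≈ sinhc½ ⊛ cosh½
sinhc≈sinhc½⊛cosh½ = X-⊛-cancel (begin
  X ⊛ sinhc
    ≈⟨ X⊛sinhc ⟩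
  κ ½ ⊛ (E 1ℚ +ₛ -ₛ E (- 1ℚ))
    ≈⟨ ⊛-congˡ (κ ½) (+ₛ-cong (λ k → sym (e₊⊛e₊ k)) (λ k → cong -_ (sym (e₋⊛e₋ k)))) ⟩
  κ ½ ⊛ (e₊ ⊛ e₊ +ₛ -ₛ (e₋ ⊛ e₋))
    ≈⟨ solve 2 (λ p m → con ½ :* (p :* p :- m :* m) := (p :- m) :* (con ½ :* (p :+ m))) (λ _ → refl) e₊ e₋ ⟩
  twoSinh½ ⊛ cosh½
    ≈⟨ ⊛-congʳ cosh½ (λ k → sym (X⊛sinhc½ k)) ⟩
  (X ⊛ sinhc½) ⊛ cosh½
    ≈⟨ ⊛-assoc X sinhc½ cosh½ ⟩
  X ⊛ (sinhc½ ⊛ cosh½)                               ∎)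
  where
  open ≈-Reasoning
  open Series-Solver

cosh½² : cosh½ ⊛ cosh½ ≈ κ 1ℚ +ₛ κ ¼ ⊛ (twoSinh½ ⊛ twoSinh½)
cosh½² = begin
  cosh½ ⊛ cosh½
    ≈⟨ solve 2 (λ p m → con ½ :* (p :+ m) :* (con ½ :* (p :+ m)) := p :* m :+ con ¼ :* ((p :- m) :* (p :- m))) (λ _ → refl) e₊ e₋ ⟩
  e₊ ⊛ e₋ +ₛ κ ¼ ⊛ (twoSinh½ ⊛ twoSinh½)
    ≈⟨ +ₛ-congʳ (κ ¼ ⊛ (twoSinh½ ⊛ twoSinh½)) e₊⊛e₋ ⟩
  κ 1ℚ +ₛ κ ¼ ⊛ (twoSinh½ ⊛ twoSinh½)                ∎
  where
  open ≈-Reasoning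
  open Series-Solver

e₋+e₊≈2cosh½ : e₋ +ₛ e₊ ≈ κ (ℕ→ℚ 2) ⊛ cosh½
e₋+e₊≈2cosh½ = solve 2 (λ m p → m :+ p := con (ℕ→ℚ 2) :* (con ½ :* (p :+ m))) (λ _ → refl) e₋ e₊
  where open Series-Solver

-e₋+e₊≈X⊛sinhc½ : -ₛ e₋ +ₛ e₊ ≈ X ⊛ sinhc½
-e₋+e₊≈X⊛sinhc½ k = trans (+-comm (- e₋ k) (e₊ k)) (sym (X⊛sinhc½ k))

θ-twoSinh½ : θ twoSinh½ ≈ X ⊛ cosh½
θ-twoSinh½ = begin
  θ (e₊ +ₛ -ₛ e₋)
    ≈⟨ (λ k → trans (θ-+ e₊ (-ₛ e₋) k) (cong (_+_ (θ e₊ k)) (θ-neg e₋ k))) ⟩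
  θ e₊ +ₛ -ₛ θ e₋
    ≈⟨ +ₛ-cong (θ-E ½) (λ k → cong -_ (θ-E (- ½) k)) ⟩
  κ ½ ⊛ (X ⊛ e₊) +ₛ -ₛ (κ (- ½) ⊛ (X ⊛ e₋))
    ≈⟨ solve 3 (λ x p m → con ½ :* (x :* p) :- con (- ½) :* (x :* m) := x :* (con ½ :* (p :+ m))) (λ _ → refl) X e₊ e₋ ⟩
  X ⊛ cosh½                                           ∎
  where
  open ≈-Reasoning
  open Series-Solver

θ-cosh½ : θ cosh½ ≈ κ ¼ ⊛ (X ⊛ twoSinh½)
θ-cosh½ = begin
  θ (κ ½ ⊛ (e₊ +ₛ e₋))
    ≈⟨ θ-⊛ (κ ½) (e₊ +ₛ e₋) ⟩
  θ (κ ½) ⊛ (e₊ +ₛ e₋) +ₛ κ ½ ⊛ θ (e₊ +ₛ e₋)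
    ≈⟨ +ₛ-cong (⊛-congʳ (e₊ +ₛ e₋) (θ-κ ½)) (⊛-congˡ (κ ½) (λ k → trans (θ-+ e₊ e₋ k) (cong₂ _+_ (θ-E ½ k) (θ-E (- ½) k)))) ⟩
  κ 0ℚ ⊛ (e₊ +ₛ e₋) +ₛ κ ½ ⊛ (κ ½ ⊛ (X ⊛ e₊) +ₛ κ (- ½) ⊛ (X ⊛ e₋))
    ≈⟨ solve 3 (λ x p m → con 0ℚ :* (p :+ m) :+ con ½ :* (con ½ :* (x :* p) :+ con (- ½) :* (x :* m))
        := con ¼ :* (x :* (p :- m)))
        (λ _ → refl) X e₊ e₋ ⟩
  κ ¼ ⊛ (X ⊛ twoSinh½)                                ∎
  where
  open ≈-Reasoning
  open Series-Solver

θ-sinhc½ : θ sinhc½ ≈ cosh½ +ₛ -ₛ sinhc½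
θ-sinhc½ = X-⊛-cancel (begin
  X ⊛ θ sinhc½
    ≈⟨ solve 4 (λ x θx s θs → x :* θs := (θx :* s :+ x :* θs) :- θx :* s) (λ _ → refl) X (θ X) sinhc½ (θ sinhc½) ⟩
  (θ X ⊛ sinhc½ +ₛ X ⊛ θ sinhc½) +ₛ -ₛ (θ X ⊛ sinhc½)
    ≈⟨ +ₛ-cong (λ k → sym (θ-⊛ X sinhc½ k)) (λ k → cong -_ (⊛-congʳ sinhc½ θ-X k)) ⟩
  θ (X ⊛ sinhc½) +ₛ -ₛ (X ⊛ sinhc½)
    ≈⟨ +ₛ-congʳ (-ₛ (X ⊛ sinhc½)) (θ-cong X⊛sinhc½) ⟩
  θ twoSinh½ +ₛ -ₛ (X ⊛ sinhc½)
    ≈⟨ +ₛ-congʳ (-ₛ (X ⊛ sinhc½)) θ-twoSinh½ ⟩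
  X ⊛ cosh½ +ₛ -ₛ (X ⊛ sinhc½)
    ≈⟨ solve 3 (λ x c s → x :* c :- x :* s := x :* (c :- s)) (λ _ → refl) X cosh½ sinhc½ ⟩
  X ⊛ (cosh½ +ₛ -ₛ sinhc½)                            ∎)
  where
  open ≈-Reasoning
  open Series-Solver

σ A : Series
σ = recip1 sinhc½
A = cosh½ ⊛ σ

sinhc½⊛σ : sinhc½ ⊛ σ ≈ κ 1ℚ
sinhc½⊛σ k = trans (⊛-recip1 sinhc½ refl k) (sym (κ-1 k))

θ-σ : θ σ ≈ σ +ₛ -ₛ (σ ⊛ A)
θ-σ = begin
  θ σ
    ≈⟨ θ-recip sinhc½⊛σ ⟩
  -ₛ ((σ ⊛ σ) ⊛ θ sinhc½)
    ≈⟨ (λ k → cong -_ (⊛-congˡ (σ ⊛ σ) θ-sinhc½ k)) ⟩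
  -ₛ ((σ ⊛ σ) ⊛ (cosh½ +ₛ -ₛ sinhc½))
    ≈⟨ solve 3 (λ σ c s → :- ((σ :* σ) :* (c :- s)) := σ :* (s :* σ) :- σ :* (c :* σ)) (λ _ → refl) σ cosh½ sinhc½ ⟩
  σ ⊛ (sinhc½ ⊛ σ) +ₛ -ₛ (σ ⊛ A)
    ≈⟨ +ₛ-congʳ (-ₛ (σ ⊛ A)) (⊛-congˡ σ sinhc½⊛σ) ⟩
  σ ⊛ κ 1ℚ +ₛ -ₛ (σ ⊛ A)
    ≈⟨ solve 2 (λ σ y → σ :* con 1ℚ :+ y := σ :+ y) (λ _ → refl) σ (-ₛ (σ ⊛ A)) ⟩
  σ +ₛ -ₛ (σ ⊛ A)                                    ∎
  where
  open ≈-Reasoning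
  open Series-Solver

θ-A : θ A ≈ κ ¼ ⊛ (X ⊛ X) +ₛ A +ₛ -ₛ (A ⊛ A)
θ-A = begin
  θ (cosh½ ⊛ σ)
    ≈⟨ θ-⊛ cosh½ σ ⟩
  θ cosh½ ⊛ σ +ₛ cosh½ ⊛ θ σ
    ≈⟨ +ₛ-cong (⊛-congʳ σ (λ k → trans (θ-cosh½ k) (⊛-congˡ (κ ¼) (⊛-congˡ X (λ j → sym (X⊛sinhc½ j))) k))) (⊛-congˡ cosh½ θ-σ) ⟩
  (κ ¼ ⊛ (X ⊛ (X ⊛ sinhc½))) ⊛ σ +ₛ cosh½ ⊛ (σ +ₛ -ₛ (σ ⊛ A))
    ≈⟨ solve 4 (λ x s σ c → con ¼ :* (x :* (x :* s)) :* σ :+ c :* (σ :- σ :* (c :* σ))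
        := con ¼ :* (x :* x) :* (s :* σ) :+ c :* σ :- (c :* σ) :* (c :* σ))
        (λ _ → refl) X sinhc½ σ cosh½ ⟩
  (κ ¼ ⊛ (X ⊛ X)) ⊛ (sinhc½ ⊛ σ) +ₛ A +ₛ -ₛ (A ⊛ A)
    ≈⟨ +ₛ-congʳ (-ₛ (A ⊛ A)) (+ₛ-congʳ A (⊛-congˡ (κ ¼ ⊛ (X ⊛ X)) sinhc½⊛σ)) ⟩
  (κ ¼ ⊛ (X ⊛ X)) ⊛ κ 1ℚ +ₛ A +ₛ -ₛ (A ⊛ A)
    ≈⟨ solve 2 (λ x a → con ¼ :* (x :* x) :* con 1ℚ :+ a :- a :* a := con ¼ :* (x :* x) :+ a :- a :* a) (λ _ → refl) X A ⟩
  κ ¼ ⊛ (X ⊛ X) +ₛ A +ₛ -ₛ (A ⊛ A)                   ∎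
  where
  open ≈-Reasoning
  open Series-Solver

A⊛A : A ⊛ A ≈ κ ¼ ⊛ (X ⊛ X) +ₛ A +ₛ -ₛ θ A
A⊛A = begin
  A ⊛ A
    ≈⟨ solve 2 (λ x a → a :* a := con ¼ :* (x :* x) :+ a :- (con ¼ :* (x :* x) :+ a :- a :* a)) (λ _ → refl) X A ⟩
  κ ¼ ⊛ (X ⊛ X) +ₛ A +ₛ -ₛ (κ ¼ ⊛ (X ⊛ X) +ₛ A +ₛ -ₛ (A ⊛ A))
                                                     ≈⟨ +ₛ-congˡ (κ ¼ ⊛ (X ⊛ X) +ₛ A) (λ k → cong -_ (sym (θ-A k))) ⟩
  κ ¼ ⊛ (X ⊛ X) +ₛ A +ₛ -ₛ θ A                       ∎
  where
  open ≈-Reasoning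
  open Series-Solver

σ⊛σ : σ ⊛ σ ≈ A +ₛ -ₛ θ A
σ⊛σ = begin
  σ ⊛ σ
    ≈⟨ solve 2 (λ d σ → σ :* σ := (con 1ℚ :+ con ¼ :* (d :* d)) :* (σ :* σ) :- con ¼ :* (d :* d) :* (σ :* σ)) (λ _ → refl) twoSinh½ σ ⟩
  (κ 1ℚ +ₛ κ ¼ ⊛ (twoSinh½ ⊛ twoSinh½)) ⊛ (σ ⊛ σ) +ₛ -ₛ ((κ ¼ ⊛ (twoSinh½ ⊛ twoSinh½)) ⊛ (σ ⊛ σ))
    ≈⟨ +ₛ-cong (⊛-congʳ (σ ⊛ σ) (λ k → sym (cosh½² k)))
          (λ k → cong -_ (⊛-congʳ (σ ⊛ σ) (⊛-congˡ (κ ¼) (⊛-cong (λ j → sym (X⊛sinhc½ j)) (λ j → sym (X⊛sinhc½ j)))) k)) ⟩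
  (cosh½ ⊛ cosh½) ⊛ (σ ⊛ σ) +ₛ -ₛ ((κ ¼ ⊛ ((X ⊛ sinhc½) ⊛ (X ⊛ sinhc½))) ⊛ (σ ⊛ σ))
    ≈⟨ solve 4 (λ x s σ c → (c :* c) :* (σ :* σ) :- (con ¼ :* ((x :* s) :* (x :* s))) :* (σ :* σ)
        := (c :* σ) :* (c :* σ) :- con ¼ :* (x :* x) :* ((s :* σ) :* (s :* σ)))
        (λ _ → refl) X sinhc½ σ cosh½ ⟩
  A ⊛ A +ₛ -ₛ ((κ ¼ ⊛ (X ⊛ X)) ⊛ ((sinhc½ ⊛ σ) ⊛ (sinhc½ ⊛ σ)))
    ≈⟨ +ₛ-cong A⊛A (λ k → cong -_ (⊛-congˡ (κ ¼ ⊛ (X ⊛ X)) (⊛-cong sinhc½⊛σ sinhc½⊛σ) k)) ⟩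
  κ ¼ ⊛ (X ⊛ X) +ₛ A +ₛ -ₛ θ A +ₛ -ₛ ((κ ¼ ⊛ (X ⊛ X)) ⊛ (κ 1ℚ ⊛ κ 1ℚ))
    ≈⟨ solve 3 (λ x a θa → con ¼ :* (x :* x) :+ a :- θa :- (con ¼ :* (x :* x)) :* (con 1ℚ :* con 1ℚ) := a :- θa) (λ _ → refl) X A (θ A) ⟩
  A +ₛ -ₛ θ A
    ∎
  where
  open ≈-Reasoning
  open Series-Solver

P : ℕ → ℚ
P m = (A ^ₛ suc m) m

P-0 : P 0 ≡ 1ℚ
P-0 = refl

A⊛A⊛ : ∀ B → A ⊛ (A ⊛ B) ≈ κ ¼ ⊛ (X ⊛ (X ⊛ B)) +ₛ A ⊛ B +ₛ -ₛ (B ⊛ θ A)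
A⊛A⊛ B = begin
  A ⊛ (A ⊛ B)
    ≈⟨ (λ k → sym (⊛-assoc A A B k)) ⟩
  (A ⊛ A) ⊛ B
    ≈⟨ ⊛-congʳ B A⊛A ⟩
  (κ ¼ ⊛ (X ⊛ X) +ₛ A +ₛ -ₛ θ A) ⊛ B
    ≈⟨ solve 4 (λ x a θa b → (con ¼ :* (x :* x) :+ a :- θa) :* b := con ¼ :* (x :* (x :* b)) :+ a :* b :- b :* θa) (λ _ → refl) X A (θ A) B ⟩
  κ ¼ ⊛ (X ⊛ (X ⊛ B)) +ₛ A ⊛ B +ₛ -ₛ (B ⊛ θ A)   ∎
  where
  open ≈-Reasoning
  open Series-Solver

P-suc-suc : ∀ m → P (suc (suc m)) ≡ ¼ * P m
P-suc-suc m = begin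
  (A ⊛ (A ⊛ Aᵐ⁺¹)) (suc (suc m))
    ≡⟨ A⊛A⊛ Aᵐ⁺¹ (suc (suc m)) ⟩
  (κ ¼ ⊛ (X ⊛ (X ⊛ Aᵐ⁺¹))) (suc (suc m)) + (A ⊛ Aᵐ⁺¹) (suc (suc m)) + - (Aᵐ⁺¹ ⊛ θ A) (suc (suc m))
    ≡⟨ cong₂ (λ u v → u + (A ⊛ Aᵐ⁺¹) (suc (suc m)) + - v)
          (trans (κ-⊛ ¼ (X ⊛ (X ⊛ Aᵐ⁺¹)) (suc (suc m))) (cong (_*_ ¼) (trans (X-⊛-suc (X ⊛ Aᵐ⁺¹) (suc m)) (X-⊛-suc Aᵐ⁺¹ m))))
            (θ-^-coeff-diag A (suc m)) ⟩
  ¼ * P m + (A ⊛ Aᵐ⁺¹) (suc (suc m)) + - (A ⊛ Aᵐ⁺¹) (suc (suc m))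
    ≡⟨ solve 2 (λ p r → p :+ r :+ :- r := p) refl (¼ * P m) ((A ⊛ Aᵐ⁺¹) (suc (suc m))) ⟩
  ¼ * P m ∎
  where
  open ≡-Reasoning
  open +-*-Solver
  Aᵐ⁺¹ = A ^ₛ suc m

σ²⊛A^ : ∀ m → (σ ⊛ σ) ⊛ (A ^ₛ m) ≈ A ^ₛ suc m +ₛ -ₛ ((A ^ₛ m) ⊛ θ A)
σ²⊛A^ m = begin
  (σ ⊛ σ) ⊛ (A ^ₛ m)                    ≈⟨ ⊛-congʳ (A ^ₛ m) σ⊛σ ⟩
  (A +ₛ -ₛ θ A) ⊛ (A ^ₛ m)              ≈⟨ solve 3 (λ a θa b → (a :- θa) :* b := a :* b :- b :* θa) (λ _ → refl) A (θ A) (A ^ₛ m) ⟩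
  A ^ₛ suc m +ₛ -ₛ ((A ^ₛ m) ⊛ θ A)     ∎
  where
  open ≈-Reasoning
  open Series-Solver

σ²⊛A^-coeff : ∀ m → ((σ ⊛ σ) ⊛ (A ^ₛ m)) m ≡ P m * (+ 1 / suc m)
σ²⊛A^-coeff m = *-cancelˡ-ℕ→ℚ-suc m (begin
  ℕ→ℚ (suc m) * ((σ ⊛ σ) ⊛ (A ^ₛ m)) m
    ≡⟨ cong (_*_ (ℕ→ℚ (suc m))) (σ²⊛A^ m m) ⟩
  ℕ→ℚ (suc m) * (P m + - t)
    ≡⟨ cong (_* (P m + - t)) (ℕ→ℚ-suc m) ⟩
  (1ℚ + ℕ→ℚ m) * (P m + - t)
    ≡⟨ solve 3 (λ n p t → (con 1ℚ :+ n) :* (p :+ :- t) := p :+ n :* p :+ :- ((con 1ℚ :+ n) :* t)) refl (ℕ→ℚ m) (P m) t ⟩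
  P m + ℕ→ℚ m * P m + - ((1ℚ + ℕ→ℚ m) * t)
    ≡⟨ cong (λ n → P m + ℕ→ℚ m * P m + - (n * t)) (ℕ→ℚ-suc m) ⟨
  P m + ℕ→ℚ m * P m + - (ℕ→ℚ (suc m) * t)
    ≡⟨ cong (λ u → P m + ℕ→ℚ m * P m + - u) (θ-^-coeff A m m) ⟩
  P m + ℕ→ℚ m * P m + - (ℕ→ℚ m * P m)
    ≡⟨ solve 2 (λ p u → p :+ u :+ :- u := p) refl (P m) (ℕ→ℚ m * P m) ⟩
  P m
    ≡⟨ *-identityʳ (P m) ⟨
  P m * 1ℚ
    ≡⟨ cong (_*_ (P m)) (1/d*d≡1 (suc m)) ⟨
  P m * (+ 1 / suc m * ℕ→ℚ (suc m))
    ≡⟨ solve 3 (λ p i n → p :* (i :* n) := n :* (p :* i)) refl (P m) (+ 1 / suc m) (ℕ→ℚ (suc m)) ⟩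
  ℕ→ℚ (suc m) * (P m * (+ 1 / suc m))           ∎)
  where
  open ≡-Reasoning
  open +-*-Solver
  t = ((A ^ₛ m) ⊛ θ A) m

P-even : ∀ n → P (2 ℕ.* n) ≡ ¼ ^ℚ n
P-even zero    = P-0
P-even (suc n) = trans (cong P (ℕ.*-suc 2 n)) (trans (P-suc-suc (2 ℕ.* n)) (cong (_*_ ¼) (P-even n)))

-- The binomial side

open import Algebra.Properties.Semiring.Mult (CommutativeRing.semiring seriesCR) using (_×_)
import Algebra.Properties.CommutativeSemiring.Binomial (CommutativeRing.commutativeSemiring seriesCR) as Binomial

×-coeff : ∀ n f j → (n × f) j ≡ ℕ→ℚ n * f j
×-coeff zero    f j = sym (*-zeroˡ (f j))
×-coeff (suc n) f j = begin
  f j + (n × f) j           ≡⟨ cong (_+_ (f j)) (×-coeff n f j) ⟩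
  f j + ℕ→ℚ n * f j         ≡⟨ solve 2 (λ x n → x :+ n :* x := (con 1ℚ :+ n) :* x) refl (f j) (ℕ→ℚ n) ⟩
  (1ℚ + ℕ→ℚ n) * f j        ≡⟨ cong (_* f j) (ℕ→ℚ-suc n) ⟨
  ℕ→ℚ (suc n) * f j         ∎
  where
  open ≡-Reasoning
  open +-*-Solver

sum-coeff : ∀ m (t : Fin m → Series) (u : ℕ → ℚ) j → (∀ i → t i j ≡ u (toℕ i)) → sum (CommutativeRing.+-rawMonoid seriesCR) t j ≡ Σ m u
sum-coeff zero    t u j eq = refl
sum-coeff (suc m) t u j eq = cong₂ _+_ (eq Fin.zero) (sum-coeff m (t ∘ Fin.suc) (u ∘ suc) j (eq ∘ Fin.suc))

binomial-coeff : ∀ N x y j →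
  ((x +ₛ y) ^ₛ N) j ≡ Σ (suc N) (λ l → ℕ→ℚ (N C l) * ((x ^ₛ l) ⊛ (y ^ₛ (N ∸ l))) j)
binomial-coeff N x y j = trans (Binomial.theorem N x y j)
  (sum-coeff (suc N) term coeff j (λ l → ×-coeff (N C toℕ l) (monomial (toℕ l)) j))
  where
  monomial : ℕ → Series
  monomial l = (x ^ₛ l) ⊛ (y ^ₛ (N ∸ l))
  term : Fin (suc N) → Series
  term l = (N C toℕ l) × monomial (toℕ l)
  coeff : ℕ → ℚ
  coeff l = ℕ→ℚ (N C l) * monomial l j

exponent : ℕ → ℕ → ℚ
exponent N l = ℕ→ℚ l * (- ½) + ℕ→ℚ (N ∸ l) * ½

e₋^⊛e₊^ : ∀ N l → (e₋ ^ₛ l) ⊛ (e₊ ^ₛ (N ∸ l)) ≈ E (exponent N l)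
e₋^⊛e₊^ N l k = trans (⊛-cong (E-^ (- ½) l) (E-^ ½ (N ∸ l)) k) (E-+ (ℕ→ℚ l * (- ½)) (ℕ→ℚ (N ∸ l) * ½) k)

-- The l-th terms of the binomial expansions of (e₋ + e₊)^N and (e₊ − e₋)^N, added;
-- e₋^l e₊^(N−l) = exp(exponent N l · x).
pairedTerm : ℕ → ℕ → ℕ → ℚ
pairedTerm N j l = ℕ→ℚ (N C l) * ((1ℚ + (- 1ℚ) ^ℚ l) * E (exponent N l) j)

binomial-pair : ∀ N j → ((e₋ +ₛ e₊) ^ₛ N) j + ((-ₛ e₋ +ₛ e₊) ^ₛ N) j ≡ Σ (suc N) (pairedTerm N j)
binomial-pair N j = begin
  ((e₋ +ₛ e₊) ^ₛ N) j + ((-ₛ e₋ +ₛ e₊) ^ₛ N) j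
    ≡⟨ cong₂ _+_ (trans (binomial-coeff N e₋ e₊ j) (Σ-cong (suc N) (λ l → cong (_*_ (Cₗ l)) (e₋^⊛e₊^ N l j))))
                 (trans (binomial-coeff N (-ₛ e₋) e₊ j) (Σ-cong (suc N) (λ l → cong (_*_ (Cₗ l)) (signed l)))) ⟩
  Σ (suc N) (λ l → Cₗ l * E (exponent N l) j) + Σ (suc N) (λ l → Cₗ l * ((- 1ℚ) ^ℚ l * E (exponent N l) j))
    ≡⟨ Σ-distrib-+ (suc N) (λ l → Cₗ l * E (exponent N l) j) (λ l → Cₗ l * ((- 1ℚ) ^ℚ l * E (exponent N l) j)) ⟨
  Σ (suc N) (λ l → Cₗ l * E (exponent N l) j + Cₗ l * ((- 1ℚ) ^ℚ l * E (exponent N l) j))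
    ≡⟨ Σ-cong (suc N) (λ l → solve 3 (λ c s e → c :* e :+ c :* (s :* e)
        := c :* ((con 1ℚ :+ s) :* e))
        refl (Cₗ l) ((- 1ℚ) ^ℚ l) (E (exponent N l) j)) ⟩
  Σ (suc N) (pairedTerm N j)
    ∎
  where
  open ≡-Reasoning
  open +-*-Solver
  Cₗ : ℕ → ℚ
  Cₗ l = ℕ→ℚ (N C l)
  signed : ∀ l → (((-ₛ e₋) ^ₛ l) ⊛ (e₊ ^ₛ (N ∸ l))) j ≡ (- 1ℚ) ^ℚ l * E (exponent N l) j
  signed l = begin
    (((-ₛ e₋) ^ₛ l) ⊛ (e₊ ^ₛ (N ∸ l))) j                      ≡⟨ ⊛-congʳ (e₊ ^ₛ (N ∸ l)) (-ₛ-^ e₋ l) j ⟩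
    ((κ ((- 1ℚ) ^ℚ l) ⊛ (e₋ ^ₛ l)) ⊛ (e₊ ^ₛ (N ∸ l))) j        ≡⟨ ⊛-assoc (κ ((- 1ℚ) ^ℚ l)) (e₋ ^ₛ l) (e₊ ^ₛ (N ∸ l)) j ⟩
    (κ ((- 1ℚ) ^ℚ l) ⊛ ((e₋ ^ₛ l) ⊛ (e₊ ^ₛ (N ∸ l)))) j        ≡⟨ κ-⊛ ((- 1ℚ) ^ℚ l) ((e₋ ^ₛ l) ⊛ (e₊ ^ₛ (N ∸ l))) j ⟩
    (- 1ℚ) ^ℚ l * ((e₋ ^ₛ l) ⊛ (e₊ ^ₛ (N ∸ l))) j              ≡⟨ cong (_*_ ((- 1ℚ) ^ℚ l)) (e₋^⊛e₊^ N l j) ⟩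
    (- 1ℚ) ^ℚ l * E (exponent N l) j                              ∎

binom : ℕ → ℕ → ℚ
binom n k = ℕ→ℚ ((4 ℕ.* n ℕ.+ 2) C (2 ℕ.* n ∸ 2 ℕ.* k))

coshSum : ℕ → Series
coshSum n j = Σ (suc n) (λ k → binom n k * (E (ℕ→ℚ (2 ℕ.* k ℕ.+ 1)) j + E (- ℕ→ℚ (2 ℕ.* k ℕ.+ 1)) j))

exponent-split : ∀ {N} a b → a ℕ.+ b ≡ N → exponent N a ≡ ℕ→ℚ a * (- ½) + ℕ→ℚ b * ½
exponent-split a b refl = cong (λ m → ℕ→ℚ a * (- ½) + ℕ→ℚ m * ½) (ℕ.m+n∸m≡n a b)

exponent-lower : ∀ c a → exponent (a ℕ.+ (c ℕ.+ c ℕ.+ a)) a ≡ ℕ→ℚ c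
exponent-lower c a = begin
  exponent (a ℕ.+ (c ℕ.+ c ℕ.+ a)) a
    ≡⟨ exponent-split a (c ℕ.+ c ℕ.+ a) refl ⟩
  ℕ→ℚ a * (- ½) + ℕ→ℚ (c ℕ.+ c ℕ.+ a) * ½
    ≡⟨ cong (λ x → ℕ→ℚ a * (- ½) + x * ½) (trans (ℕ→ℚ-homo-+ (c ℕ.+ c) a) (cong (_+ ℕ→ℚ a) (ℕ→ℚ-homo-+ c c))) ⟩
  ℕ→ℚ a * (- ½) + (ℕ→ℚ c + ℕ→ℚ c + ℕ→ℚ a) * ½
    ≡⟨ solve 2 (λ a c → a :* con (- ½) :+ (c :+ c :+ a) :* con ½ := c) refl (ℕ→ℚ a) (ℕ→ℚ c) ⟩
  ℕ→ℚ c                                                 ∎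
  where
  open ≡-Reasoning
  open +-*-Solver

exponent-upper : ∀ c b → exponent ((c ℕ.+ c ℕ.+ b) ℕ.+ b) (c ℕ.+ c ℕ.+ b) ≡ - ℕ→ℚ c
exponent-upper c b = begin
  exponent ((c ℕ.+ c ℕ.+ b) ℕ.+ b) (c ℕ.+ c ℕ.+ b)
    ≡⟨ exponent-split (c ℕ.+ c ℕ.+ b) b refl ⟩
  ℕ→ℚ (c ℕ.+ c ℕ.+ b) * (- ½) + ℕ→ℚ b * ½
    ≡⟨ cong (λ x → x * (- ½) + ℕ→ℚ b * ½) (trans (ℕ→ℚ-homo-+ (c ℕ.+ c) b) (cong (_+ ℕ→ℚ b) (ℕ→ℚ-homo-+ c c))) ⟩
  (ℕ→ℚ c + ℕ→ℚ c + ℕ→ℚ b) * (- ½) + ℕ→ℚ b * ½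
    ≡⟨ solve 2 (λ b c → (c :+ c :+ b) :* con (- ½) :+ b :* con ½ := :- c) refl (ℕ→ℚ b) (ℕ→ℚ c) ⟩
  - ℕ→ℚ c                                               ∎
  where
  open ≡-Reasoning
  open +-*-Solver

pairedTerm-odd : ∀ N j m → pairedTerm N j (suc (2 ℕ.* m)) ≡ 0ℚ
pairedTerm-odd N j m = begin
  ℕ→ℚ (N C suc (2 ℕ.* m)) * ((1ℚ + - 1ℚ * (- 1ℚ) ^ℚ (2 ℕ.* m)) * e)
    ≡⟨ cong (λ s → ℕ→ℚ (N C suc (2 ℕ.* m)) * ((1ℚ + - 1ℚ * s) * e)) (-1^-even m) ⟩
  ℕ→ℚ (N C suc (2 ℕ.* m)) * ((1ℚ + - 1ℚ * 1ℚ) * e)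
    ≡⟨ solve 2 (λ c e → c :* ((con 1ℚ :+ :- con 1ℚ :* con 1ℚ) :* e) := con 0ℚ) refl (ℕ→ℚ (N C suc (2 ℕ.* m))) e ⟩
  0ℚ                                                                   ∎
  where
  open ≡-Reasoning
  open +-*-Solver
  e = E (exponent N (suc (2 ℕ.* m))) j

pairedTerm-lower : ∀ k d j → pairedTerm (4 ℕ.* (k ℕ.+ d) ℕ.+ 2) j (2 ℕ.* d) ≡ (1ℚ + 1ℚ) * (binom (k ℕ.+ d) k * E (ℕ→ℚ (2 ℕ.* k ℕ.+ 1)) j)
pairedTerm-lower k d j = begin
  ℕ→ℚ (N C (2 ℕ.* d)) * ((1ℚ + (- 1ℚ) ^ℚ (2 ℕ.* d)) * E (exponent N (2 ℕ.* d)) j)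
    ≡⟨ cong₂ (λ s x → ℕ→ℚ (N C (2 ℕ.* d)) * ((1ℚ + s) * E x j)) (-1^-even d)
          (subst (λ M → exponent M (2 ℕ.* d) ≡ ℕ→ℚ c) (sym N≡) (exponent-lower c (2 ℕ.* d))) ⟩
  ℕ→ℚ (N C (2 ℕ.* d)) * ((1ℚ + 1ℚ) * E (ℕ→ℚ c) j)
    ≡⟨ cong (λ i → ℕ→ℚ (N C i) * ((1ℚ + 1ℚ) * E (ℕ→ℚ c) j)) index≡ ⟩
  binom (k ℕ.+ d) k * ((1ℚ + 1ℚ) * E (ℕ→ℚ c) j)
    ≡⟨ solve 3 (λ b t e → b :* (t :* e) := t :* (b :* e)) refl (binom (k ℕ.+ d) k) (1ℚ + 1ℚ) (E (ℕ→ℚ c) j) ⟩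
  (1ℚ + 1ℚ) * (binom (k ℕ.+ d) k * E (ℕ→ℚ c) j)
    ∎
  where
  open ≡-Reasoning
  open +-*-Solver
  c = 2 ℕ.* k ℕ.+ 1
  N = 4 ℕ.* (k ℕ.+ d) ℕ.+ 2
  N≡ : N ≡ 2 ℕ.* d ℕ.+ (c ℕ.+ c ℕ.+ 2 ℕ.* d)
  N≡ = lemma k d
    where
    lemma : ∀ k d → 4 ℕ.* (k ℕ.+ d) ℕ.+ 2 ≡ 2 ℕ.* d ℕ.+ ((2 ℕ.* k ℕ.+ 1) ℕ.+ (2 ℕ.* k ℕ.+ 1) ℕ.+ 2 ℕ.* d)
    lemma = solve-∀
  index≡ : 2 ℕ.* d ≡ 2 ℕ.* (k ℕ.+ d) ∸ 2 ℕ.* k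
  index≡ = sym (trans (cong (_∸ 2 ℕ.* k) (ℕ.*-distribˡ-+ 2 k d)) (ℕ.m+n∸m≡n (2 ℕ.* k) (2 ℕ.* d)))

pairedTerm-upper : ∀ k d j → pairedTerm (4 ℕ.* (k ℕ.+ d) ℕ.+ 2) j (2 ℕ.* (suc (k ℕ.+ d) ℕ.+ k)) ≡ (1ℚ + 1ℚ) * (binom (k ℕ.+ d) k * E (- ℕ→ℚ (2 ℕ.* k ℕ.+ 1)) j)
pairedTerm-upper k d j = begin
  ℕ→ℚ (N C l) * ((1ℚ + (- 1ℚ) ^ℚ l) * E (exponent N l) j)
    ≡⟨ cong₂ (λ s x → ℕ→ℚ (N C l) * ((1ℚ + s) * E x j)) (-1^-even (suc (k ℕ.+ d) ℕ.+ k)) exponent≡ ⟩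
  ℕ→ℚ (N C l) * ((1ℚ + 1ℚ) * E (- ℕ→ℚ c) j)
    ≡⟨ cong (λ b → ℕ→ℚ b * ((1ℚ + 1ℚ) * E (- ℕ→ℚ c) j)) binom≡ ⟩
  binom (k ℕ.+ d) k * ((1ℚ + 1ℚ) * E (- ℕ→ℚ c) j)
    ≡⟨ solve 3 (λ b t e → b :* (t :* e) := t :* (b :* e)) refl (binom (k ℕ.+ d) k) (1ℚ + 1ℚ) (E (- ℕ→ℚ c) j) ⟩
  (1ℚ + 1ℚ) * (binom (k ℕ.+ d) k * E (- ℕ→ℚ c) j)
    ∎
  where
  open ≡-Reasoning
  open +-*-Solver
  c = 2 ℕ.* k ℕ.+ 1
  N = 4 ℕ.* (k ℕ.+ d) ℕ.+ 2
  l = 2 ℕ.* (suc (k ℕ.+ d) ℕ.+ k)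
  l≡ : l ≡ c ℕ.+ c ℕ.+ 2 ℕ.* d
  l≡ = lemma k d
    where
    lemma : ∀ k d → 2 ℕ.* (suc (k ℕ.+ d) ℕ.+ k) ≡ (2 ℕ.* k ℕ.+ 1) ℕ.+ (2 ℕ.* k ℕ.+ 1) ℕ.+ 2 ℕ.* d
    lemma = solve-∀
  N≡ : N ≡ l ℕ.+ 2 ℕ.* d
  N≡ = lemma k d
    where
    lemma : ∀ k d → 4 ℕ.* (k ℕ.+ d) ℕ.+ 2 ≡ 2 ℕ.* (suc (k ℕ.+ d) ℕ.+ k) ℕ.+ 2 ℕ.* d
    lemma = solve-∀
  exponent≡ : exponent N l ≡ - ℕ→ℚ c
  exponent≡ = trans (cong (λ M → exponent M l) N≡) (trans (cong (λ i → exponent (i ℕ.+ 2 ℕ.* d) i) l≡) (exponent-upper c (2 ℕ.* d)))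
  binom≡ : N C l ≡ N C (2 ℕ.* (k ℕ.+ d) ∸ 2 ℕ.* k)
  binom≡ = begin
    N C l                              ≡⟨ nCk≡nC[n∸k] (subst (l ℕ.≤_) (sym N≡) (ℕ.m≤m+n l (2 ℕ.* d))) ⟩
    N C (N ∸ l)                        ≡⟨ cong (λ i → N C (i ∸ l)) N≡ ⟩
    N C (l ℕ.+ 2 ℕ.* d ∸ l)            ≡⟨ cong (N C_) (ℕ.m+n∸m≡n l (2 ℕ.* d)) ⟩
    N C (2 ℕ.* d)                      ≡⟨ cong (N C_) (trans (cong (_∸ 2 ℕ.* k) (ℕ.*-distribˡ-+ 2 k d)) (ℕ.m+n∸m≡n (2 ℕ.* k) (2 ℕ.* d))) ⟨
    N C (2 ℕ.* (k ℕ.+ d) ∸ 2 ℕ.* k)    ∎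

coshSum-pairing : ∀ n j → Σ (suc (4 ℕ.* n ℕ.+ 2)) (pairedTerm (4 ℕ.* n ℕ.+ 2) j) ≡ (1ℚ + 1ℚ) * coshSum n j
coshSum-pairing n j = begin
  Σ (suc N) T
    ≡⟨ cong (λ i → Σ (suc i) T) N≡ ⟩
  Σ (suc (2 ℕ.* suc (2 ℕ.* n))) T
    ≡⟨ Σ-even-odd (suc (2 ℕ.* n)) T ⟩
  Σ (suc (suc (2 ℕ.* n))) (λ m → T (2 ℕ.* m)) + Σ (suc (2 ℕ.* n)) (λ m → T (suc (2 ℕ.* m)))
    ≡⟨ cong₂ _+_ (cong (λ i → Σ i (λ m → T (2 ℕ.* m))) M≡) (trans (Σ-cong (suc (2 ℕ.* n)) (pairedTerm-odd N j)) (Σ-zero (suc (2 ℕ.* n)))) ⟩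
  Σ (suc n ℕ.+ suc n) (λ m → T (2 ℕ.* m)) + 0ℚ
    ≡⟨ trans (+-identityʳ _) (Σ-split (suc n) (suc n) (λ m → T (2 ℕ.* m))) ⟩
  Σ (suc n) (λ m → T (2 ℕ.* m)) + Σ (suc n) (λ k → T (2 ℕ.* (suc n ℕ.+ k)))
    ≡⟨ cong (_+ Σ (suc n) (λ k → T (2 ℕ.* (suc n ℕ.+ k)))) (Σ-reverse (suc n) (λ m → T (2 ℕ.* m))) ⟩
  Σ (suc n) (λ k → T (2 ℕ.* (n ∸ k))) + Σ (suc n) (λ k → T (2 ℕ.* (suc n ℕ.+ k)))
    ≡⟨ cong₂ _+_ (Σ-cong-< (suc n) (λ k k<n → lower k (ℕ.≤-pred k<n))) (Σ-cong-< (suc n) (λ k k<n → upper k (ℕ.≤-pred k<n))) ⟩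
  Σ (suc n) (λ k → two * (binom n k * E (c k) j)) + Σ (suc n) (λ k → two * (binom n k * E (- c k) j))
    ≡⟨ Σ-distrib-+ (suc n) (λ k → two * (binom n k * E (c k) j)) (λ k → two * (binom n k * E (- c k) j)) ⟨
  Σ (suc n) (λ k → two * (binom n k * E (c k) j) + two * (binom n k * E (- c k) j))
    ≡⟨ Σ-cong (suc n) (λ k → solve 4 (λ t b e e′ → t :* (b :* e) :+ t :* (b :* e′)
        := t :* (b :* (e :+ e′)))
        refl two (binom n k) (E (c k) j) (E (- c k) j)) ⟩
  Σ (suc n) (λ k → two * (binom n k * (E (c k) j + E (- c k) j)))
    ≡⟨ *-distribˡ-Σ (suc n) two (λ k → binom n k * (E (c k) j + E (- c k) j)) ⟨
  two * coshSum n j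
    ∎
  where
  open ≡-Reasoning
  open +-*-Solver
  N = 4 ℕ.* n ℕ.+ 2
  T = pairedTerm N j
  two = 1ℚ + 1ℚ
  c : ℕ → ℚ
  c k = ℕ→ℚ (2 ℕ.* k ℕ.+ 1)
  N≡ : N ≡ 2 ℕ.* suc (2 ℕ.* n)
  N≡ = lemma n
    where
    lemma : ∀ n → 4 ℕ.* n ℕ.+ 2 ≡ 2 ℕ.* suc (2 ℕ.* n)
    lemma = solve-∀
  M≡ : suc (suc (2 ℕ.* n)) ≡ suc n ℕ.+ suc n
  M≡ = lemma n
    where
    lemma : ∀ n → suc (suc (2 ℕ.* n)) ≡ suc n ℕ.+ suc n
    lemma = solve-∀
  lower : ∀ k → k ℕ.≤ n → T (2 ℕ.* (n ∸ k)) ≡ two * (binom n k * E (c k) j)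
  lower k k≤n with n ∸ k | ℕ.m+[n∸m]≡n k≤n
  ... | d | refl = pairedTerm-lower k d j
  upper : ∀ k → k ℕ.≤ n → T (2 ℕ.* (suc n ℕ.+ k)) ≡ two * (binom n k * E (- c k) j)
  upper k k≤n with n ∸ k | ℕ.m+[n∸m]≡n k≤n
  ... | d | refl = pairedTerm-upper k d j

coshSum-odd : ∀ n l → coshSum n (suc (2 ℕ.* l)) ≡ 0ℚ
coshSum-odd n l = trans (Σ-cong (suc n) cancel) (Σ-zero (suc n))
  where
  cancel : ∀ k → binom n k * (E (ℕ→ℚ (2 ℕ.* k ℕ.+ 1)) (suc (2 ℕ.* l)) + E (- ℕ→ℚ (2 ℕ.* k ℕ.+ 1)) (suc (2 ℕ.* l))) ≡ 0ℚ
  cancel k = trans (cong (λ e → binom n k * (E (ℕ→ℚ (2 ℕ.* k ℕ.+ 1)) (suc (2 ℕ.* l)) + e)) (E-neg-odd (ℕ→ℚ (2 ℕ.* k ℕ.+ 1)) l))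
    (trans (cong (_*_ (binom n k)) (+-inverseʳ (E (ℕ→ℚ (2 ℕ.* k ℕ.+ 1)) (suc (2 ℕ.* l))))) (*-zeroʳ (binom n k)))

powerSum : ℕ → ℕ → ℚ
powerSum n j = sumTo n (λ k → ℕ→ℚ (((4 ℕ.* n ℕ.+ 2) C (2 ℕ.* n ∸ 2 ℕ.* k)) ℕ.* ((2 ℕ.* k ℕ.+ 1) ^ j)))

powerSum-even : ∀ n l → invFact (2 ℕ.* l) * powerSum n (2 ℕ.* l) ≡ ½ * coshSum n (2 ℕ.* l)
powerSum-even n l = begin
  i * powerSum n j
    ≡⟨ cong (_*_ i) (trans (sumTo≡Σ n term) (Σ-cong (suc n) term≡)) ⟩
  i * Σ (suc n) (λ k → binom n k * c k ^ℚ j)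
    ≡⟨ *-distribˡ-Σ (suc n) i (λ k → binom n k * c k ^ℚ j) ⟩
  Σ (suc n) (λ k → i * (binom n k * c k ^ℚ j))
    ≡⟨ Σ-cong (suc n) (λ k → trans (solve 3 (λ i b p → i :* (b :* p) := con ½ :* (b :* (p :* i :+ p :* i))) refl i (binom n k) (c k ^ℚ j))
                                   (cong (λ e → ½ * (binom n k * (E (c k) j + e))) (sym (E-neg-even (c k) l)))) ⟩
  Σ (suc n) (λ k → ½ * (binom n k * (E (c k) j + E (- c k) j)))
    ≡⟨ *-distribˡ-Σ (suc n) ½ (λ k → binom n k * (E (c k) j + E (- c k) j)) ⟨
  ½ * coshSum n j
    ∎
  where
  open ≡-Reasoning
  open +-*-Solver
  j = 2 ℕ.* l
  i = invFact j
  c : ℕ → ℚ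
  c k = ℕ→ℚ (2 ℕ.* k ℕ.+ 1)
  term : ℕ → ℚ
  term k = ℕ→ℚ (((4 ℕ.* n ℕ.+ 2) C (2 ℕ.* n ∸ 2 ℕ.* k)) ℕ.* ((2 ℕ.* k ℕ.+ 1) ^ j))
  term≡ : ∀ k → term k ≡ binom n k * c k ^ℚ j
  term≡ k = trans (ℕ→ℚ-homo-* ((4 ℕ.* n ℕ.+ 2) C (2 ℕ.* n ∸ 2 ℕ.* k)) ((2 ℕ.* k ℕ.+ 1) ^ j))
                  (cong (_*_ (binom n k)) (ℕ→ℚ-homo-^ (2 ℕ.* k ℕ.+ 1) j))

-- The coefficient of x^(2n) in R n ⊛ H n

-- R n = (x / sinh x)^(2n+2); its k-th coefficient is d k (suc n) by definition.
R : ℕ → Series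
R n = recip1 (sinhc ^S (2 ℕ.* suc n))

R⊛sinhc^ : ∀ n → R n ⊛ (sinhc ^ₛ (2 ℕ.* suc n)) ≈ κ 1ℚ
R⊛sinhc^ n k = begin
  (R n ⊛ (sinhc ^ₛ M)) k     ≡⟨ ⊛-congˡ (R n) (λ j → sym (^S≈^ₛ sinhc M j)) k ⟩
  (R n ⊛ (sinhc ^S M)) k     ≡⟨ ⊛-comm (R n) (sinhc ^S M) k ⟩
  ((sinhc ^S M) ⊛ R n) k     ≡⟨ ⊛-recip1 (sinhc ^S M) (^S-coeff-zero sinhc M refl) k ⟩
  oneS k                     ≡⟨ κ-1 k ⟨
  κ 1ℚ k                     ∎
  where
  open ≡-Reasoning
  M = 2 ℕ.* suc n

R⊛cosh½^[2n+2] : ∀ n → R n ⊛ (cosh½ ^ₛ (2 ℕ.* suc n)) ≈ σ ^ₛ (2 ℕ.* suc n)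
R⊛cosh½^[2n+2] n = begin
  R n ⊛ (cosh½ ^ₛ M)
    ≈⟨ solve 2 (λ r c → r :* c := r :* c :* con 1ℚ) (λ _ → refl) (R n) (cosh½ ^ₛ M) ⟩
  (R n ⊛ (cosh½ ^ₛ M)) ⊛ κ 1ℚ
    ≈⟨ ⊛-congˡ (R n ⊛ (cosh½ ^ₛ M)) (λ k → sym (sinhc½^⊛σ^ k)) ⟩
  (R n ⊛ (cosh½ ^ₛ M)) ⊛ ((sinhc½ ^ₛ M) ⊛ (σ ^ₛ M))
    ≈⟨ solve 4 (λ r c s σ → r :* c :* (s :* σ) := r :* (s :* c) :* σ) (λ _ → refl) (R n) (cosh½ ^ₛ M) (sinhc½ ^ₛ M) (σ ^ₛ M) ⟩
  (R n ⊛ ((sinhc½ ^ₛ M) ⊛ (cosh½ ^ₛ M))) ⊛ (σ ^ₛ M)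
    ≈⟨ ⊛-congʳ (σ ^ₛ M) (⊛-congˡ (R n) sinhc½^⊛cosh½^) ⟩
  (R n ⊛ (sinhc ^ₛ M)) ⊛ (σ ^ₛ M)
    ≈⟨ ⊛-congʳ (σ ^ₛ M) (R⊛sinhc^ n) ⟩
  κ 1ℚ ⊛ (σ ^ₛ M)
    ≈⟨ solve 1 (λ x → con 1ℚ :* x := x) (λ _ → refl) (σ ^ₛ M) ⟩
  σ ^ₛ M
    ∎
  where
  open ≈-Reasoning
  open Series-Solver
  M = 2 ℕ.* suc n
  sinhc½^⊛σ^ : (sinhc½ ^ₛ M) ⊛ (σ ^ₛ M) ≈ κ 1ℚ
  sinhc½^⊛σ^ k = trans (sym (Series-Exp.^-distrib-* sinhc½ σ M k))
    (trans (Series-Exp.^-congˡ M sinhc½⊛σ k) (trans (κ-^ 1ℚ M k) (cong (λ a → κ a k) (1^ℚ M))))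
  sinhc½^⊛cosh½^ : (sinhc½ ^ₛ M) ⊛ (cosh½ ^ₛ M) ≈ sinhc ^ₛ M
  sinhc½^⊛cosh½^ k = trans (sym (Series-Exp.^-distrib-* sinhc½ cosh½ M k)) (Series-Exp.^-congˡ M (λ j → sym (sinhc≈sinhc½⊛cosh½ j)) k)

R⊛cosh½^[4n+2] : ∀ n → R n ⊛ (cosh½ ^ₛ (4 ℕ.* n ℕ.+ 2)) ≈ (σ ⊛ σ) ⊛ (A ^ₛ (2 ℕ.* n))
R⊛cosh½^[4n+2] n = begin
  R n ⊛ (cosh½ ^ₛ (4 ℕ.* n ℕ.+ 2))
    ≈⟨ ⊛-congˡ (R n) (λ k → trans (Series-Exp.^-congʳ cosh½ N≡ k) (Series-Exp.^-homo-* cosh½ M m k)) ⟩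
  R n ⊛ ((cosh½ ^ₛ M) ⊛ (cosh½ ^ₛ m))
    ≈⟨ (λ k → sym (⊛-assoc (R n) (cosh½ ^ₛ M) (cosh½ ^ₛ m) k)) ⟩
  (R n ⊛ (cosh½ ^ₛ M)) ⊛ (cosh½ ^ₛ m)
    ≈⟨ ⊛-congʳ (cosh½ ^ₛ m) (λ k → trans (R⊛cosh½^[2n+2] n k) (Series-Exp.^-congʳ σ (ℕ.*-suc 2 n) k)) ⟩
  (σ ⊛ (σ ⊛ (σ ^ₛ m))) ⊛ (cosh½ ^ₛ m)
    ≈⟨ solve 3 (λ σ σm cm → σ :* (σ :* σm) :* cm := σ :* σ :* (cm :* σm)) (λ _ → refl) σ (σ ^ₛ m) (cosh½ ^ₛ m) ⟩
  (σ ⊛ σ) ⊛ ((cosh½ ^ₛ m) ⊛ (σ ^ₛ m))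
    ≈⟨ ⊛-congˡ (σ ⊛ σ) (λ k → sym (Series-Exp.^-distrib-* cosh½ σ m k)) ⟩
  (σ ⊛ σ) ⊛ (A ^ₛ m)
    ∎
  where
  open ≈-Reasoning
  open Series-Solver
  M = 2 ℕ.* suc n
  m = 2 ℕ.* n
  N≡ : 4 ℕ.* n ℕ.+ 2 ≡ M ℕ.+ m
  N≡ = lemma n
    where
    lemma : ∀ n → 4 ℕ.* n ℕ.+ 2 ≡ 2 ℕ.* suc n ℕ.+ 2 ℕ.* n
    lemma = solve-∀

H : ℕ → Series
H n = κ ½ ⊛ coshSum n

H-odd : ∀ n l → H n (suc (2 ℕ.* l)) ≡ 0ℚ
H-odd n l = trans (κ-⊛ ½ (coshSum n) (suc (2 ℕ.* l))) (trans (cong (_*_ ½) (coshSum-odd n l)) (*-zeroʳ ½))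

H≈binomials : ∀ n → H n ≈ κ ¼ ⊛ ((κ (ℕ→ℚ 2) ⊛ cosh½) ^ₛ (4 ℕ.* n ℕ.+ 2) +ₛ (X ⊛ sinhc½) ^ₛ (4 ℕ.* n ℕ.+ 2))
H≈binomials n j = begin
  (κ ½ ⊛ coshSum n) j
    ≡⟨ κ-⊛ ½ (coshSum n) j ⟩
  ½ * coshSum n j
    ≡⟨ solve 1 (λ g → con ½ :* g := con ¼ :* ((con 1ℚ :+ con 1ℚ) :* g)) refl (coshSum n j) ⟩
  ¼ * ((1ℚ + 1ℚ) * coshSum n j)
    ≡⟨ cong (_*_ ¼) (trans (sym (coshSum-pairing n j)) (sym (binomial-pair N j))) ⟩
  ¼ * (((e₋ +ₛ e₊) ^ₛ N) j + ((-ₛ e₋ +ₛ e₊) ^ₛ N) j)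
    ≡⟨ cong (_*_ ¼) (cong₂ _+_ (Series-Exp.^-congˡ N e₋+e₊≈2cosh½ j) (Series-Exp.^-congˡ N -e₋+e₊≈X⊛sinhc½ j)) ⟩
  ¼ * (((κ (ℕ→ℚ 2) ⊛ cosh½) ^ₛ N) j + ((X ⊛ sinhc½) ^ₛ N) j)
    ≡⟨ κ-⊛ ¼ ((κ (ℕ→ℚ 2) ⊛ cosh½) ^ₛ N +ₛ (X ⊛ sinhc½) ^ₛ N) j ⟨
  (κ ¼ ⊛ ((κ (ℕ→ℚ 2) ⊛ cosh½) ^ₛ N +ₛ (X ⊛ sinhc½) ^ₛ N)) j     ∎
  where
  open ≡-Reasoning
  open +-*-Solver
  N = 4 ℕ.* n ℕ.+ 2

R⊛H : ∀ n → R n ⊛ H n ≈ κ ¼ ⊛ (κ (ℕ→ℚ 2 ^ℚ (4 ℕ.* n ℕ.+ 2)) ⊛ ((σ ⊛ σ) ⊛ (A ^ₛ (2 ℕ.* n)))) +ₛ (X ^ₛ (4 ℕ.* n ℕ.+ 2)) ⊛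
  (κ ¼ ⊛ (R n ⊛ (sinhc½ ^ₛ (4 ℕ.* n ℕ.+ 2))))
R⊛H n = begin
  R n ⊛ H n
    ≈⟨ ⊛-congˡ (R n) (H≈binomials n) ⟩
  R n ⊛ (κ ¼ ⊛ ((κ (ℕ→ℚ 2) ⊛ cosh½) ^ₛ N +ₛ (X ⊛ sinhc½) ^ₛ N))
    ≈⟨ ⊛-congˡ (R n) (⊛-congˡ (κ ¼) (+ₛ-cong (λ k → trans (Series-Exp.^-distrib-* (κ (ℕ→ℚ 2)) cosh½ N k) (⊛-congʳ (cosh½ ^ₛ N) (κ-^ (ℕ→ℚ 2) N) k))
                                             (Series-Exp.^-distrib-* X sinhc½ N))) ⟩
  R n ⊛ (κ ¼ ⊛ (κ (ℕ→ℚ 2 ^ℚ N) ⊛ (cosh½ ^ₛ N) +ₛ (X ^ₛ N) ⊛ (sinhc½ ^ₛ N)))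
    ≈⟨ solve 6 (λ r q t c x s → r :* (q :* (t :* c :+ x :* s))
        := q :* (t :* (r :* c)) :+ x :* (q :* (r :* s)))
        (λ _ → refl) (R n) (κ ¼) (κ (ℕ→ℚ 2 ^ℚ N)) (cosh½ ^ₛ N) (X ^ₛ N) (sinhc½ ^ₛ N) ⟩
  κ ¼ ⊛ (κ (ℕ→ℚ 2 ^ℚ N) ⊛ (R n ⊛ (cosh½ ^ₛ N))) +ₛ (X ^ₛ N) ⊛ (κ ¼ ⊛ (R n ⊛ (sinhc½ ^ₛ N)))
    ≈⟨ +ₛ-congʳ ((X ^ₛ N) ⊛ (κ ¼ ⊛ (R n ⊛ (sinhc½ ^ₛ N)))) (⊛-congˡ (κ ¼) (⊛-congˡ (κ (ℕ→ℚ 2 ^ℚ N)) (R⊛cosh½^[4n+2] n))) ⟩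
  κ ¼ ⊛ (κ (ℕ→ℚ 2 ^ℚ N) ⊛ ((σ ⊛ σ) ⊛ (A ^ₛ (2 ℕ.* n)))) +ₛ (X ^ₛ N) ⊛ (κ ¼ ⊛ (R n ⊛ (sinhc½ ^ₛ N)))
    ∎
  where
  open ≈-Reasoning
  open Series-Solver
  N = 4 ℕ.* n ℕ.+ 2

R⊛H-coeff : ∀ n → (R n ⊛ H n) (2 ℕ.* n) ≡ ¼ * (ℕ→ℚ 2 ^ℚ (4 ℕ.* n ℕ.+ 2) * (P (2 ℕ.* n) * (+ 1 / suc (2 ℕ.* n))))
R⊛H-coeff n = begin
  (R n ⊛ H n) (2 ℕ.* n)
    ≡⟨ R⊛H n (2 ℕ.* n) ⟩
  (κ ¼ ⊛ (κ t ⊛ ((σ ⊛ σ) ⊛ (A ^ₛ (2 ℕ.* n))))) (2 ℕ.* n) + ((X ^ₛ N) ⊛ (κ ¼ ⊛ (R n ⊛ (sinhc½ ^ₛ N)))) (2 ℕ.* n)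
    ≡⟨ cong₂ _+_ main (X^-⊛-below N (κ ¼ ⊛ (R n ⊛ (sinhc½ ^ₛ N))) 2n<N) ⟩
  ¼ * (t * (P (2 ℕ.* n) * (+ 1 / suc (2 ℕ.* n)))) + 0ℚ
    ≡⟨ +-identityʳ _ ⟩
  ¼ * (t * (P (2 ℕ.* n) * (+ 1 / suc (2 ℕ.* n))))
    ∎
  where
  open ≡-Reasoning
  N = 4 ℕ.* n ℕ.+ 2
  t = ℕ→ℚ 2 ^ℚ N
  main : (κ ¼ ⊛ (κ t ⊛ ((σ ⊛ σ) ⊛ (A ^ₛ (2 ℕ.* n))))) (2 ℕ.* n) ≡ ¼ * (t * (P (2 ℕ.* n) * (+ 1 / suc (2 ℕ.* n))))
  main = begin
    (κ ¼ ⊛ (κ t ⊛ ((σ ⊛ σ) ⊛ (A ^ₛ (2 ℕ.* n))))) (2 ℕ.* n)   ≡⟨ κ-⊛ ¼ (κ t ⊛ ((σ ⊛ σ) ⊛ (A ^ₛ (2 ℕ.* n)))) (2 ℕ.* n) ⟩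
    ¼ * (κ t ⊛ ((σ ⊛ σ) ⊛ (A ^ₛ (2 ℕ.* n)))) (2 ℕ.* n)       ≡⟨ cong (_*_ ¼) (κ-⊛ t ((σ ⊛ σ) ⊛ (A ^ₛ (2 ℕ.* n))) (2 ℕ.* n)) ⟩
    ¼ * (t * ((σ ⊛ σ) ⊛ (A ^ₛ (2 ℕ.* n))) (2 ℕ.* n))         ≡⟨ cong (λ x → ¼ * (t * x)) (σ²⊛A^-coeff (2 ℕ.* n)) ⟩
    ¼ * (t * (P (2 ℕ.* n) * (+ 1 / suc (2 ℕ.* n))))          ∎
  2n<N : 2 ℕ.* n ℕ.< N
  2n<N = subst (suc (2 ℕ.* n) ℕ.≤_) (lemma n) (ℕ.m≤m+n (suc (2 ℕ.* n)) (suc (2 ℕ.* n)))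
    where
    lemma : ∀ n → suc (2 ℕ.* n) ℕ.+ suc (2 ℕ.* n) ≡ 4 ℕ.* n ℕ.+ 2
    lemma = solve-∀

¼*2^[4n+2]*¼^n : ∀ n → ¼ * (ℕ→ℚ 2 ^ℚ (4 ℕ.* n ℕ.+ 2) * ¼ ^ℚ n) ≡ ℕ→ℚ (4 ^ n)
¼*2^[4n+2]*¼^n zero    = refl
¼*2^[4n+2]*¼^n (suc n) = begin
  ¼ * (ℕ→ℚ 2 ^ℚ (4 ℕ.* suc n ℕ.+ 2) * (¼ * ¼ ^ℚ n))
    ≡⟨ cong (λ e → ¼ * (ℕ→ℚ 2 ^ℚ e * (¼ * ¼ ^ℚ n))) (lemma n) ⟩
  ¼ * (ℕ→ℚ 2 ^ℚ (4 ℕ.+ (4 ℕ.* n ℕ.+ 2)) * (¼ * ¼ ^ℚ n))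
    ≡⟨ solve 2 (λ p r → con ¼ :* ((con (ℕ→ℚ 2) :* (con (ℕ→ℚ 2) :* (con (ℕ→ℚ 2) :* (con (ℕ→ℚ 2) :* p)))) :* (con ¼ :* r))
        := con (ℕ→ℚ 4) :* (con ¼ :* (p :* r)))
        refl (ℕ→ℚ 2 ^ℚ (4 ℕ.* n ℕ.+ 2)) (¼ ^ℚ n) ⟩
  ℕ→ℚ 4 * (¼ * (ℕ→ℚ 2 ^ℚ (4 ℕ.* n ℕ.+ 2) * ¼ ^ℚ n))
    ≡⟨ cong (_*_ (ℕ→ℚ 4)) (¼*2^[4n+2]*¼^n n) ⟩
  ℕ→ℚ 4 * ℕ→ℚ (4 ^ n)
    ≡⟨ ℕ→ℚ-homo-* 4 (4 ^ n) ⟨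
  ℕ→ℚ (4 ^ suc n)                                      ∎
  where
  open ≡-Reasoning
  open +-*-Solver
  lemma : ∀ n → 4 ℕ.* suc n ℕ.+ 2 ≡ 4 ℕ.+ (4 ℕ.* n ℕ.+ 2)
  lemma = solve-∀

2n∸odd : ∀ n m → m ℕ.< n → 2 ℕ.* n ∸ suc (2 ℕ.* m) ≡ suc (2 ℕ.* (n ∸ suc m))
2n∸odd n m m<n with n ∸ suc m | ℕ.m+[n∸m]≡n m<n
... | d | refl = trans (cong (_∸ suc (2 ℕ.* m)) (lemma m d)) (ℕ.m+n∸m≡n (suc (2 ℕ.* m)) (suc (2 ℕ.* d)))
  where
  lemma : ∀ m d → 2 ℕ.* (suc m ℕ.+ d) ≡ suc (2 ℕ.* m) ℕ.+ suc (2 ℕ.* d)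
  lemma = solve-∀

R⊛H-as-Σ : ∀ n → (R n ⊛ H n) (2 ℕ.* n) ≡ Σ (suc n) (λ m → R n (2 ℕ.* m) * H n (2 ℕ.* n ∸ 2 ℕ.* m))
R⊛H-as-Σ n = begin
  (R n ⊛ H n) (2 ℕ.* n)
    ≡⟨ ⊛-coeff (R n) (H n) (2 ℕ.* n) ⟩
  Σ (suc (2 ℕ.* n)) (λ i → R n i * H n (2 ℕ.* n ∸ i))
    ≡⟨ Σ-even-odd n (λ i → R n i * H n (2 ℕ.* n ∸ i)) ⟩
  Σ (suc n) (λ m → R n (2 ℕ.* m) * H n (2 ℕ.* n ∸ 2 ℕ.* m)) + Σ n (λ m → R n (suc (2 ℕ.* m)) * H n (2 ℕ.* n ∸ suc (2 ℕ.* m)))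
    ≡⟨ cong (_+_ evens) (trans (Σ-cong-< n odd-vanishes) (Σ-zero n)) ⟩
  Σ (suc n) (λ m → R n (2 ℕ.* m) * H n (2 ℕ.* n ∸ 2 ℕ.* m)) + 0ℚ
    ≡⟨ +-identityʳ evens ⟩
  Σ (suc n) (λ m → R n (2 ℕ.* m) * H n (2 ℕ.* n ∸ 2 ℕ.* m))
    ∎
  where
  open ≡-Reasoning
  evens = Σ (suc n) (λ m → R n (2 ℕ.* m) * H n (2 ℕ.* n ∸ 2 ℕ.* m))
  odd-vanishes : ∀ m → m ℕ.< n → R n (suc (2 ℕ.* m)) * H n (2 ℕ.* n ∸ suc (2 ℕ.* m)) ≡ 0ℚ
  odd-vanishes m m<n = trans (cong (λ i → R n (suc (2 ℕ.* m)) * H n i) (2n∸odd n m m<n))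
    (trans (cong (_*_ (R n (suc (2 ℕ.* m)))) (H-odd n (n ∸ suc m))) (*-zeroʳ (R n (suc (2 ℕ.* m)))))

powerSum≡H : ∀ n m → invFact (2 ℕ.* n ∸ 2 ℕ.* m) * powerSum n (2 ℕ.* n ∸ 2 ℕ.* m) ≡ H n (2 ℕ.* n ∸ 2 ℕ.* m)
powerSum≡H n m = begin
  inner (2 ℕ.* n ∸ 2 ℕ.* m)           ≡⟨ cong inner (ℕ.*-distribˡ-∸ 2 n m) ⟨
  inner (2 ℕ.* (n ∸ m))               ≡⟨ powerSum-even n (n ∸ m) ⟩
  ½ * coshSum n (2 ℕ.* (n ∸ m))       ≡⟨ κ-⊛ ½ (coshSum n) (2 ℕ.* (n ∸ m)) ⟨
  H n (2 ℕ.* (n ∸ m))                 ≡⟨ cong (H n) (ℕ.*-distribˡ-∸ 2 n m) ⟩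
  H n (2 ℕ.* n ∸ 2 ℕ.* m)             ∎
  where
  open ≡-Reasoning
  inner : ℕ → ℚ
  inner j = invFact j * powerSum n j

lhs≡Σ : ∀ n → sumTo n (λ m → d (2 ℕ.* m) (suc n) * invFact (2 ℕ.* n ∸ 2 ℕ.* m) * powerSum n (2 ℕ.* n ∸ 2 ℕ.* m))
             ≡ Σ (suc n) (λ m → R n (2 ℕ.* m) * H n (2 ℕ.* n ∸ 2 ℕ.* m))
lhs≡Σ n = trans (sumTo≡Σ n (λ m → d (2 ℕ.* m) (suc n) * invFact (2 ℕ.* n ∸ 2 ℕ.* m) * powerSum n (2 ℕ.* n ∸ 2 ℕ.* m)))
  (Σ-cong (suc n) (λ m → trans (*-assoc (R n (2 ℕ.* m)) (invFact (2 ℕ.* n ∸ 2 ℕ.* m)) (powerSum n (2 ℕ.* n ∸ 2 ℕ.* m)))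
                                (cong (_*_ (R n (2 ℕ.* m))) (powerSum≡H n m))))

coefficient-value : ∀ n → ¼ * (ℕ→ℚ 2 ^ℚ (4 ℕ.* n ℕ.+ 2) * (P (2 ℕ.* n) * (+ 1 / suc (2 ℕ.* n)))) ≡ + (4 ^ n) / suc (2 ℕ.* n)
coefficient-value n = begin
  ¼ * (t * (P (2 ℕ.* n) * i))          ≡⟨ cong (λ p → ¼ * (t * (p * i))) (P-even n) ⟩
  ¼ * (t * (¼ ^ℚ n * i))               ≡⟨ solve 4 (λ q t p i → q :* (t :* (p :* i)) := q :* (t :* p) :* i) refl ¼ t (¼ ^ℚ n) i ⟩
  ¼ * (t * ¼ ^ℚ n) * i                 ≡⟨ cong (_* i) (¼*2^[4n+2]*¼^n n) ⟩
  ℕ→ℚ (4 ^ n) * i                      ≡⟨ a/d≡a*1/d (4 ^ n) (suc (2 ℕ.* n)) ⟨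
  + (4 ^ n) / suc (2 ℕ.* n)            ∎
  where
  open ≡-Reasoning
  open +-*-Solver
  t = ℕ→ℚ 2 ^ℚ (4 ℕ.* n ℕ.+ 2)
  i = + 1 / suc (2 ℕ.* n)

mainTheorem10 : (n : ℕ) →
    sumTo n (λ m → d (2 ℕ.* m) (suc n) * invFact (2 ℕ.* n ∸ 2 ℕ.* m)
        * sumTo n (λ k → ℕ→ℚ (((4 ℕ.* n ℕ.+ 2) C (2 ℕ.* n ∸ 2 ℕ.* k)) ℕ.* ((2 ℕ.* k ℕ.+ 1) ^ (2 ℕ.* n ∸ 2 ℕ.* m)))))
      ≡ _/_ (+ (4 ^ n)) (suc (2 ℕ.* n))
mainTheorem10 n = begin
  _                                                              ≡⟨ lhs≡Σ n ⟩
  Σ (suc n) (λ m → R n (2 ℕ.* m) * H n (2 ℕ.* n ∸ 2 ℕ.* m))      ≡⟨ R⊛H-as-Σ n ⟨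
  (R n ⊛ H n) (2 ℕ.* n)                                          ≡⟨ R⊛H-coeff n ⟩
  ¼ * (ℕ→ℚ 2 ^ℚ (4 ℕ.* n ℕ.+ 2) * (P (2 ℕ.* n) * (+ 1 / suc (2 ℕ.* n))))  ≡⟨ coefficient-value n ⟩
  + (4 ^ n) / suc (2 ℕ.* n)                                      ∎
  where open ≡-Reasoning
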